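{- Let $A$ be a finite alphabet and $L \subseteq A^*$. The following properties are equivalent: (1) $L \in \mathrm{MSO}[\le,\mathrm{Arb}_1]$, i.e. there exist an MSO sentence $\varphi(P_1,\ldots,P_\ell)$ and monadic predicates $\mathbf{P}_1,\ldots,\mathbf{P}_\ell$ with $L = L_{\varphi,\mathbf{P}_1,\ldots,\mathbf{P}_\ell}$; (2) $L$ is recognized by a non-deterministic automaton with advice; (3) $L$ is recognized by a deterministic automaton with advice; (4) there exists $K \in \mathbb{N}$ such that for all $i,p \in \mathbb{N}$, the restriction of the equivalence relation $\sim_{L,p}$ to the words of length $i$ has at most $K$ equivalence classes; (5) $L$ is recognized by a one-scan program.
   Context: Words are $u = u_0\cdots u_{n-1}$ with positions $0,\ldots,n-1$. A (numerical) monadic predicate is a family $\mathbf{P} = (\mathbf{P}_n)_{n\in\mathbb{N}}$ with $\mathbf{P}_n \subseteq \{0,\ldots,n-1\}$; $\mathrm{Arb}_1$ is the class of all such predicates (no computability assumption). MSO formulae are built by $\varphi ::= \mathbf{a}(x) \mid x \le y \mid P(x) \mid \varphi\wedge\varphi \mid \neg\varphi \mid \exists x\,\varphi \mid \exists X\,\varphi$, with first-order variables ranging over positions, second-order variables over sets of positions, $\mathbf{a}(x)$ meaning position $x$ carries letter $a$, $\le$ the order on positions, and for a word $u$ of length $n$, $P(y)$ holds iff the position $y$ belongs to $\mathbf{P}_n$, where $\mathbf{P}$ interprets the symbol $P$. For a sentence $\varphi(P_1,\dots,P_\ell)$ and predicates $\mathbf{P}_1,\dots,\mathbf{P}_\ell$,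 $L_{\varphi,\mathbf{P}_1,\ldots,\mathbf{P}_\ell} = \{u \in A^* \mid u,\mathbf{P}_1,\ldots,\mathbf{P}_\ell \models \varphi\}$. A non-deterministic automaton with advice is $\mathcal{A} = (Q,q_0,\delta,F)$ with $Q$ finite, $q_0\in Q$, $\delta \subseteq \mathbb{N}\times\mathbb{N}\times Q\times A\times Q$ and $F \subseteq \mathbb{N}\times Q$; it is deterministic if $\delta$ is a function $\mathbb{N}\times\mathbb{N}\times Q\times A \to Q$. A run on $u = u_0\cdots u_{n-1}$ is $q_0 q_1\cdots q_n \in Q^*$ with $(i,n,q_i,u_i,q_{i+1}) \in \delta$ for all $i<n$; it is accepting if $(n,q_n)\in F$; $\mathcal{A}$ recognizes the set of words having an accepting run. A one-scan program is $(M,(f_{i,n}: A \to M)_{i,n\in\mathbb{N}},S)$ with $M$ a finite monoid and $S\subseteq M$; it accepts $u = u_0\cdots u_{n-1}$ iff $f_{0,n}(u_0)\cdots f_{n-1,n}(u_{n-1}) \in S$. For $p\in\mathbb{N}$, $u \sim_{L,p} v$ iff for all $w \in A^p$: $uw\in L \Leftrightarrow vw \in L$. -}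

module Defs where

open import Data.Nat using (ℕ; zero; suc; _≤_)
open import Data.Fin using (Fin; toℕ; inject₁; _≟_)
import Data.Fin as F
open import Data.Bool using (Bool; true; false)
open import Data.List using (List; []; _∷_; length; lookup)
open import Data.Product using (Σ; _×_; _,_)
open import Data.Empty using (⊥)
open import Relation.Nullary using (¬_)
open import Relation.Nullary.Decidable using (⌊_⌋)
open import Relation.Binary.PropositionalEquality using (_≡_)
open import Algebra.Structures using (IsMonoid)
open import Function.Bundles using (_⇔_)
import Data.Vec.Functional as VF

Word : ℕ → Set
Word k = List (Fin k)

-- Languages, monadic predicates, transition relations, final sets and
-- accepting subsets are all subsets, represented by characteristic functions.
Language : ℕ → Set
Language k = Word k → Bool

-- A numerical monadic predicate: P n y = true  iff  y ∈ P_n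
-- (values for y ≥ n are irrelevant).
MonPred : Set
MonPred = ℕ → ℕ → Bool

-- MSO syntax (de Bruijn), with ℓ predicate symbols, f free first-order
-- and s free second-order variables.

data Formula (k ℓ : ℕ) : ℕ → ℕ → Set where
  letter : ∀ {f s} → Fin k → Fin f → Formula k ℓ f s
  leq    : ∀ {f s} → Fin f → Fin f → Formula k ℓ f s
  pred   : ∀ {f s} → Fin ℓ → Fin f → Formula k ℓ f s
  mem    : ∀ {f s} → Fin f → Fin s → Formula k ℓ f s
  and    : ∀ {f s} → Formula k ℓ f s → Formula k ℓ f s → Formula k ℓ f s
  neg    : ∀ {f s} → Formula k ℓ f s → Formula k ℓ f s
  ex1    : ∀ {f s} → Formula k ℓ (suc f) s → Formula k ℓ f s
  ex2    : ∀ {f s} → Formula k ℓ f (suc s) → Formula k ℓ f s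

Sentence : ℕ → ℕ → Set
Sentence k ℓ = Formula k ℓ 0 0

Sat : ∀ {k ℓ f s} (u : Word k) (Ps : Fin ℓ → MonPred) → Formula k ℓ f s →
      (Fin f → Fin (length u)) → (Fin s → Fin (length u) → Bool) → Set
Sat u Ps (letter a x) ρ σ = lookup u (ρ x) ≡ a
Sat u Ps (leq x y)    ρ σ = toℕ (ρ x) ≤ toℕ (ρ y)
Sat u Ps (pred j x)   ρ σ = Ps j (length u) (toℕ (ρ x)) ≡ true
Sat u Ps (mem x X)    ρ σ = σ X (ρ x) ≡ true
Sat u Ps (and φ ψ)    ρ σ = Sat u Ps φ ρ σ × Sat u Ps ψ ρ σ
Sat u Ps (neg φ)      ρ σ = ¬ Sat u Ps φ ρ σ
Sat u Ps (ex1 φ)      ρ σ = Σ (Fin (length u)) λ p → Sat u Ps φ (p VF.∷ ρ) σ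
Sat u Ps (ex2 φ)      ρ σ = Σ (Fin (length u) → Bool) λ X → Sat u Ps φ ρ (X VF.∷ σ)

Models : ∀ {k ℓ} → Word k → (Fin ℓ → MonPred) → Sentence k ℓ → Set
Models u Ps φ = Sat u Ps φ (λ ()) (λ ())

MSODefinable : ∀ {k} → Language k → Set
MSODefinable {k} L =
  Σ ℕ λ ℓ → Σ (Sentence k ℓ) λ φ → Σ (Fin ℓ → MonPred) λ Ps →
    ∀ (u : Word k) → (L u ≡ true) ⇔ Models u Ps φ

record NAutomaton (k : ℕ) : Set where
  field
    m  : ℕ
    q₀ : Fin m
    δ  : ℕ → ℕ → Fin m → Fin k → Fin m → Bool
    Fin' : ℕ → Fin m → Bool

NAccepts : ∀ {k} → NAutomaton k → Word k → Set
NAccepts A u = Σ (Fin (suc n) → Fin m) λ r →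
    (r F.zero ≡ q₀)
  × (∀ (i : Fin n) → δ (toℕ i) n (r (inject₁ i)) (lookup u i) (r (F.suc i)) ≡ true)
  × (Fin' n (r (F.fromℕ n)) ≡ true)
  where
    open NAutomaton A
    n = length u

record DAutomaton (k : ℕ) : Set where
  field
    m  : ℕ
    q₀ : Fin m
    δ  : ℕ → ℕ → Fin m → Fin k → Fin m
    Fin' : ℕ → Fin m → Bool

DtoN : ∀ {k} → DAutomaton k → NAutomaton k
DtoN D = record { m = m ; q₀ = q₀
                ; δ = λ i n q a q' → ⌊ δ i n q a ≟ q' ⌋
                ; Fin' = Fin' }
  where open DAutomaton D

NRecognizable : ∀ {k} → Language k → Set
NRecognizable {k} L = Σ (NAutomaton k) λ A → ∀ u → (L u ≡ true) ⇔ NAccepts A u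

DRecognizable : ∀ {k} → Language k → Set
DRecognizable {k} L = Σ (DAutomaton k) λ D → ∀ u → (L u ≡ true) ⇔ NAccepts (DtoN D) u

Sim : ∀ {k} → Language k → ℕ → Word k → Word k → Set
Sim {k} L p u v = ∀ (w : Word k) → length w ≡ p →
  (L (u Data.List.++ w) ≡ true) ⇔ (L (v Data.List.++ w) ≡ true)

-- "∼_{L,p} restricted to words of length i has at most K classes":
-- there is an injection of the quotient into Fin K, i.e. a map c into Fin K
-- with  c u ≡ c v ⇔ u ∼_{L,p} v  on words of length i.
BoundedIndex : ∀ {k} → Language k → Set
BoundedIndex {k} L = Σ ℕ λ K → ∀ (i p : ℕ) → Σ (Word k → Fin K) λ c →
  ∀ (u v : Word k) → length u ≡ i → length v ≡ i → (c u ≡ c v) ⇔ Sim L p u v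

record OneScan (k : ℕ) : Set where
  field
    m   : ℕ
    _·_ : Fin m → Fin m → Fin m
    e   : Fin m
    isMonoid : IsMonoid _≡_ _·_ e
    f   : ℕ → ℕ → Fin k → Fin m
    S   : Fin m → Bool

scanFrom : ∀ {k} → (P : OneScan k) → ℕ → ℕ → Word k → Fin (OneScan.m P)
scanFrom P i n [] = OneScan.e P
scanFrom P i n (a ∷ w) = OneScan._·_ P (OneScan.f P i n a) (scanFrom P (suc i) n w)

OAccepts : ∀ {k} → OneScan k → Word k → Set
OAccepts P u = OneScan.S P (scanFrom P 0 (length u) u) ≡ true

OneScanRecognizable : ∀ {k} → Language k → Set
OneScanRecognizable {k} L = Σ (OneScan k) λ P → ∀ u → (L u ≡ true) ⇔ OAccepts P u

module Submission where

-- All five conditions are compared through one auxiliary notion: a finite colouring of each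
-- length-i slice of A* whose colour classes refine ∼_{L,p} (RefinedBoundedIndex).  Languages
-- of one-scan programs and of automata with advice have such colourings (the product of the
-- prefix in the monoid, resp. the set of states reachable on the prefix), and languages of MSO
-- formulae over letters annotated with the valuation of the free variables have them by
-- induction on the formula: atoms are decided by a bounded amount of information about the
-- prefix, Boolean operations take products of colourings, and a set quantifier takes the
-- powerset of a colouring.  Giving each word the least colour occurring in its class turns
-- such a colouring into an exact bound on the number of classes (BoundedIndex).  Conversely, a
-- bound K on the classes gives a deterministic automaton with advice whose state after
-- reading i letters of a word of length n is the ∼_{L,n−i}-class of the prefix; its runs are
-- products in the monoid of transformations of its states (a one-scan program) and are
-- described by an MSO sentence guessing one set of positions per state, with the transition
-- and final relations provided as monadic predicates.

open import Defs
open import Data.Nat using (ℕ)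
open import Data.Product using (_×_)
open import Function.Bundles using (_⇔_)

open import Data.Nat as N using (zero; suc; _+_; _*_; _∸_; _≤_; _<_; z≤n; s≤s; _≤ᵇ_; _≡ᵇ_; _^_)
import Data.Nat.Properties as NP
open import Data.Bool using (Bool; true; false; _∧_; _∨_; not; if_then_else_)
open import Data.Bool.Properties using (T-≡)
open import Data.Bool.ListAction using (or)
open import Data.Fin as F using (Fin; toℕ; inject₁; fromℕ; fromℕ<; combine; remQuot; funToFin; finToFun; _↑ˡ_; _↑ʳ_; splitAt)
import Data.Fin.Properties as FP
open import Data.List as L using (List; []; _∷_; length; _++_; map; lookup)
import Data.List.Properties as LP
open import Data.Maybe as M using (Maybe; just; nothing; fromMaybe)
open import Data.Product using (Σ; _,_; proj₁; proj₂)
open import Data.Sum using (_⊎_; inj₁; inj₂; [_,_]′)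
open import Data.Empty using (⊥; ⊥-elim)
open import Relation.Nullary using (yes; no)
open import Relation.Nullary.Decidable using (⌊_⌋)
open import Relation.Binary.PropositionalEquality
open import Function.Bundles using (mk⇔; Equivalence)
open import Function.Properties.Equivalence using () renaming (trans to ⇔-trans; sym to ⇔-sym)
open import Algebra.Structures using (IsMonoid)
import Data.Vec.Functional as VF

∧-trueˡ : ∀ {a b} → a ∧ b ≡ true → a ≡ true
∧-trueˡ {true} _ = refl

∧-trueʳ : ∀ {a b} → a ∧ b ≡ true → b ≡ true
∧-trueʳ {true} e = e

∧-true : ∀ {a b} → a ≡ true → b ≡ true → a ∧ b ≡ true
∧-true refl refl = refl

∧-true⁻ : ∀ {a b} → a ∧ b ≡ true → a ≡ true × b ≡ true
∧-true⁻ {true} e = refl , e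

∨-true⁻ : ∀ {a b} → a ∨ b ≡ true → a ≡ true ⊎ b ≡ true
∨-true⁻ {true} _ = inj₁ refl
∨-true⁻ {false} e = inj₂ e

∨-trueˡ : ∀ {a b} → a ≡ true → a ∨ b ≡ true
∨-trueˡ refl = refl

∨-trueʳ : ∀ {a b} → b ≡ true → a ∨ b ≡ true
∨-trueʳ {true} _ = refl
∨-trueʳ {false} e = e

false≢true : ∀ {b} → b ≡ false → b ≡ true → ⊥
false≢true refl ()

not-true⁻ : ∀ {a} → not a ≡ true → a ≡ false
not-true⁻ {false} _ = refl

not-true : ∀ {a} → a ≡ false → not a ≡ true
not-true refl = refl

≡true-ext : ∀ {a b} → (a ≡ true → b ≡ true) → (b ≡ true → a ≡ true) → a ≡ b
≡true-ext {true} {true} f g = refl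
≡true-ext {true} {false} f g = sym (f refl)
≡true-ext {false} {true} f g = g refl
≡true-ext {false} {false} f g = refl

true-or-false : ∀ b → b ≡ true ⊎ b ≡ false
true-or-false true = inj₁ refl
true-or-false false = inj₂ refl

≤ᵇ-true⇒≤ : ∀ {a b} → (a ≤ᵇ b) ≡ true → a ≤ b
≤ᵇ-true⇒≤ {a} {b} e = NP.≤ᵇ⇒≤ a b (Equivalence.from T-≡ e)

≤⇒≤ᵇ-true : ∀ {a b} → a ≤ b → (a ≤ᵇ b) ≡ true
≤⇒≤ᵇ-true le = Equivalence.to T-≡ (NP.≤⇒≤ᵇ le)

>⇒≤ᵇ-false : ∀ {a b} → b < a → (a ≤ᵇ b) ≡ false
>⇒≤ᵇ-false {a} {b} lt with true-or-false (a ≤ᵇ b)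
... | inj₁ e = ⊥-elim (NP.<⇒≱ lt (≤ᵇ-true⇒≤ e))
... | inj₂ e = e

≤ᵇ-refl : ∀ p → (p ≤ᵇ p) ≡ true
≤ᵇ-refl p = ≤⇒≤ᵇ-true {p} {p} NP.≤-refl

≤ᵇ-cancelˡ-+ : ∀ i a b → (i + a ≤ᵇ i + b) ≡ (a ≤ᵇ b)
≤ᵇ-cancelˡ-+ i a b = ≡true-ext (λ e → ≤⇒≤ᵇ-true (NP.+-cancelˡ-≤ i a b (≤ᵇ-true⇒≤ e)))
                               (λ e → ≤⇒≤ᵇ-true (NP.+-monoʳ-≤ i (≤ᵇ-true⇒≤ e)))

_==_ : Bool → Bool → Bool
true == b = b
false == b = not b

==⇒≡ : ∀ {a b} → (a == b) ≡ true → a ≡ b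
==⇒≡ {true} e = sym e
==⇒≡ {false} {false} e = refl

==-refl : ∀ a → (a == a) ≡ true
==-refl true = refl
==-refl false = refl

_≟ᵇ_ : ∀ {n} → Fin n → Fin n → Bool
a ≟ᵇ b = ⌊ a F.≟ b ⌋

≟ᵇ⇒≡ : ∀ {n} {a b : Fin n} → (a ≟ᵇ b) ≡ true → a ≡ b
≟ᵇ⇒≡ {a = a} {b} e with a F.≟ b
... | yes a≡b = a≡b

≟ᵇ-refl : ∀ {n} (a : Fin n) → (a ≟ᵇ a) ≡ true
≟ᵇ-refl a with a F.≟ a
... | yes _ = refl
... | no a≢a = ⊥-elim (a≢a refl)

maybe′-≟ᵇ-true : ∀ {k} {a : Fin k} d → M.maybe′ (_≟ᵇ a) false d ≡ true → d ≡ just a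
maybe′-≟ᵇ-true (just b) e = cong just (≟ᵇ⇒≡ e)

-- Bounded quantifiers as Boolean functions

anyBelow : ℕ → (ℕ → Bool) → Bool
anyBelow zero g = false
anyBelow (suc n) g = anyBelow n g ∨ g n

anyBelow-sound : ∀ n g → anyBelow n g ≡ true → Σ ℕ λ p → p < n × g p ≡ true
anyBelow-sound (suc n) g e with ∨-true⁻ {anyBelow n g} e
... | inj₁ e' = let (p , p<n , gp) = anyBelow-sound n g e' in p , NP.m≤n⇒m≤1+n p<n , gp
... | inj₂ e' = n , NP.≤-refl , e'

anyBelow-complete : ∀ n g p → p < n → g p ≡ true → anyBelow n g ≡ true
anyBelow-complete (suc n) g p p<1+n e with NP.m≤n⇒m<n∨m≡n (NP.≤-pred p<1+n)
... | inj₁ p<n = ∨-trueˡ (anyBelow-complete n g p p<n e)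
... | inj₂ refl = ∨-trueʳ {anyBelow p g} e

anyBelow-cong : ∀ n g h → (∀ p → p < n → g p ≡ h p) → anyBelow n g ≡ anyBelow n h
anyBelow-cong zero g h eq = refl
anyBelow-cong (suc n) g h eq =
  cong₂ _∨_ (anyBelow-cong n g h (λ p lt → eq p (NP.m≤n⇒m≤1+n lt))) (eq n NP.≤-refl)

anyBelow-false : ∀ n → anyBelow n (λ _ → false) ≡ false
anyBelow-false zero = refl
anyBelow-false (suc n) rewrite anyBelow-false n = refl

anyFin : ∀ m → (Fin m → Bool) → Bool
anyFin zero g = false
anyFin (suc m) g = g F.zero ∨ anyFin m (λ x → g (F.suc x))

anyFin-sound : ∀ m g → anyFin m g ≡ true → Σ (Fin m) λ x → g x ≡ true
anyFin-sound (suc m) g e with ∨-true⁻ {g F.zero} e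
... | inj₁ e' = F.zero , e'
... | inj₂ e' = let (x , gx) = anyFin-sound m _ e' in F.suc x , gx

anyFin-complete : ∀ m g x → g x ≡ true → anyFin m g ≡ true
anyFin-complete (suc m) g F.zero e = ∨-trueˡ e
anyFin-complete (suc m) g (F.suc x) e = ∨-trueʳ {g F.zero} (anyFin-complete m _ x e)

firstJust : ∀ {X : Set} m → (Fin m → Maybe X) → Maybe X
firstJust zero h = nothing
firstJust (suc m) h = h F.zero M.<∣> firstJust m (λ a → h (F.suc a))

firstJust-sound : ∀ {X : Set} m (h : Fin m → Maybe X) {x} → firstJust m h ≡ just x → Σ (Fin m) λ a → h a ≡ just x
firstJust-sound (suc m) h e with h F.zero in e₀
... | just y = F.zero , trans e₀ e
... | nothing = let (a , ea) = firstJust-sound m _ e in F.suc a , ea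

firstJust-complete : ∀ {X : Set} m (h : Fin m → Maybe X) a {x} → h a ≡ just x → Σ X λ y → firstJust m h ≡ just y
firstJust-complete (suc m) h F.zero {x} e rewrite e = x , refl
firstJust-complete (suc m) h (F.suc a) e with h F.zero
... | just y = y , refl
... | nothing = firstJust-complete m _ a e

firstJust-cong : ∀ {X : Set} m (h h' : Fin m → Maybe X) → (∀ a → h a ≡ h' a) → firstJust m h ≡ firstJust m h'
firstJust-cong zero h h' eq = refl
firstJust-cong (suc m) h h' eq = cong₂ M._<∣>_ (eq F.zero) (firstJust-cong m _ _ (λ a → eq (F.suc a)))

module _ {A : Set} {m : ℕ} (elt : Fin m → A) where

  anyOfLength : ℕ → (List A → Bool) → Bool
  anyOfLength zero g = g []
  anyOfLength (suc n) g = anyFin m (λ x → anyOfLength n (λ t → g (elt x ∷ t)))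

  anyOfLength-sound : ∀ n g → anyOfLength n g ≡ true → Σ (List A) λ t → length t ≡ n × g t ≡ true
  anyOfLength-sound zero g e = [] , refl , e
  anyOfLength-sound (suc n) g e =
    let (x , ex) = anyFin-sound m _ e ; (t , lt , gt) = anyOfLength-sound n _ ex in
    elt x ∷ t , cong suc lt , gt

  findOfLength : ℕ → (List A → Bool) → Maybe (List A)
  findOfLength zero g = if g [] then just [] else nothing
  findOfLength (suc n) g = firstJust m (λ x → M.map (elt x ∷_) (findOfLength n (λ t → g (elt x ∷ t))))

  findOfLength-sound : ∀ n g {t} → findOfLength n g ≡ just t → length t ≡ n × g t ≡ true
  findOfLength-sound zero g e with g [] in eg
  findOfLength-sound zero g refl | true = refl , eg
  findOfLength-sound (suc n) g e with firstJust-sound m _ e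
  ... | x , ex with findOfLength n (λ t → g (elt x ∷ t)) in et
  findOfLength-sound (suc n) g e | x , refl | just t = let (lt , gt) = findOfLength-sound n _ et in cong suc lt , gt

  module _ (elt-surjective : ∀ a → Σ (Fin m) λ x → elt x ≡ a) where

    anyOfLength-complete : ∀ n g t → length t ≡ n → g t ≡ true → anyOfLength n g ≡ true
    anyOfLength-complete zero g [] l e = e
    anyOfLength-complete (suc n) g (a ∷ t) l e with elt-surjective a
    ... | x , refl = anyFin-complete m _ x (anyOfLength-complete n _ t (NP.suc-injective l) e)

    findOfLength-complete : ∀ n g t → length t ≡ n → g t ≡ true → Σ (List A) λ t' → findOfLength n g ≡ just t'
    findOfLength-complete zero g [] l e rewrite e = [] , refl
    findOfLength-complete (suc n) g (a ∷ t) l e with elt-surjective a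
    ... | x , refl with findOfLength-complete n (λ t → g (elt x ∷ t)) t (NP.suc-injective l) e
    ...   | t' , et' = firstJust-complete m _ x (cong (M.map (elt x ∷_)) et')

    anyOfLength-cong : ∀ n g h → (∀ t → length t ≡ n → g t ≡ h t) → anyOfLength n g ≡ anyOfLength n h
    anyOfLength-cong n g h eq = ≡true-ext
      (λ e → let (t , l , gt) = anyOfLength-sound n g e in
             anyOfLength-complete n h t l (trans (sym (eq t l)) gt))
      (λ e → let (t , l , gt) = anyOfLength-sound n h e in
             anyOfLength-complete n g t l (trans (eq t l) gt))

fromBool : Bool → Fin 2
fromBool false = F.zero
fromBool true = F.suc F.zero

toBool : Fin 2 → Bool
toBool F.zero = false
toBool (F.suc _) = true

toBool-fromBool : ∀ b → toBool (fromBool b) ≡ b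
toBool-fromBool false = refl
toBool-fromBool true = refl

anyBits : ℕ → (List Bool → Bool) → Bool
anyBits = anyOfLength toBool

anyBits-sound : ∀ n g → anyBits n g ≡ true → Σ (List Bool) λ t → length t ≡ n × g t ≡ true
anyBits-sound = anyOfLength-sound toBool

anyBits-complete : ∀ n g t → length t ≡ n → g t ≡ true → anyBits n g ≡ true
anyBits-complete = anyOfLength-complete toBool (λ b → fromBool b , toBool-fromBool b)

anyBits-cong : ∀ n g h → (∀ t → length t ≡ n → g t ≡ h t) → anyBits n g ≡ anyBits n h
anyBits-cong = anyOfLength-cong toBool (λ b → fromBool b , toBool-fromBool b)

-- Colourings refining ∼_{L,p}

module _ {Σ' : Set} where

  SameFuture : (List Σ' → Bool) → ℕ → List Σ' → List Σ' → Set
  SameFuture L p u v = ∀ w → length w ≡ p → L (u ++ w) ≡ L (v ++ w)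

  RefinedBoundedIndex : (List Σ' → Bool) → Set
  RefinedBoundedIndex L = Σ ℕ λ K → ∀ i p → Σ (List Σ' → Fin K) λ c →
    ∀ u v → length u ≡ i → length v ≡ i → c u ≡ c v → SameFuture L p u v

  refinedBoundedIndex-factor : ∀ (L : List Σ' → Bool) (K : ℕ) →
    (∀ i p → Σ (List Σ' → Fin K) λ c → Σ (Fin K → List Σ' → Bool) λ h →
      ∀ u w → length u ≡ i → length w ≡ p → L (u ++ w) ≡ h (c u) w) →
    RefinedBoundedIndex L
  refinedBoundedIndex-factor L K H = K , λ i p → let (c , h , eq) = H i p in
    c , λ u v lu lv cu≡cv w lw →
      trans (eq u w lu lw) (trans (cong (λ z → h z w) cu≡cv) (sym (eq v w lv lw)))

  refinedBoundedIndex-resp : ∀ {L L' : List Σ' → Bool} → (∀ w → L w ≡ L' w) →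
    RefinedBoundedIndex L → RefinedBoundedIndex L'
  refinedBoundedIndex-resp eq (K , H) = K , λ i p → let (c , hc) = H i p in
    c , λ u v lu lv e w lw → trans (sym (eq _)) (trans (hc u v lu lv e w lw) (eq _))

  refinedBoundedIndex-zipWith : ∀ (g : Bool → Bool → Bool) {L₁ L₂ : List Σ' → Bool} →
    RefinedBoundedIndex L₁ → RefinedBoundedIndex L₂ → RefinedBoundedIndex (λ w → g (L₁ w) (L₂ w))
  refinedBoundedIndex-zipWith g (K₁ , H₁) (K₂ , H₂) = K₁ * K₂ , λ i p →
    let (c₁ , h₁) = H₁ i p ; (c₂ , h₂) = H₂ i p in
    (λ u → combine (c₁ u) (c₂ u)) , λ u v lu lv e w lw →
      let (e₁ , e₂) = FP.combine-injective (c₁ u) (c₂ u) (c₁ v) (c₂ v) e in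
      cong₂ g (h₁ u v lu lv e₁ w lw) (h₂ u v lu lv e₂ w lw)

refinedBoundedIndex-map : ∀ {Σ₁ Σ₂ : Set} (e : Σ₁ → Σ₂) {L : List Σ₂ → Bool} →
  RefinedBoundedIndex L → RefinedBoundedIndex (λ u → L (map e u))
refinedBoundedIndex-map e {L} (K , H) = K , λ i p → let (c , h) = H i p in
  (λ u → c (map e u)) , λ u v lu lv eq w lw → begin
    L (map e (u ++ w))       ≡⟨ cong L (LP.map-++ e u w) ⟩
    L (map e u ++ map e w)   ≡⟨ h (map e u) (map e v) (trans (LP.length-map e u) lu)
                                  (trans (LP.length-map e v) lv) eq (map e w) (trans (LP.length-map e w) lw) ⟩
    L (map e v ++ map e w)   ≡⟨ cong L (LP.map-++ e v w) ⟨
    L (map e (v ++ w))       ∎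
  where open ≡-Reasoning

encodeSubset : ∀ {K} → (Fin K → Bool) → Fin (2 ^ K)
encodeSubset g = funToFin (λ x → fromBool (g x))

encodeSubset-injective : ∀ {K} (g h : Fin K → Bool) → encodeSubset g ≡ encodeSubset h → ∀ x → g x ≡ h x
encodeSubset-injective g h e x = begin
  g x                                     ≡⟨ toBool-fromBool (g x) ⟨
  toBool (fromBool (g x))                 ≡⟨ cong toBool (FP.finToFun-funToFin (λ y → fromBool (g y)) x) ⟨
  toBool (finToFun (encodeSubset g) x)    ≡⟨ cong (λ z → toBool (finToFun z x)) e ⟩
  toBool (finToFun (encodeSubset h) x)    ≡⟨ cong toBool (FP.finToFun-funToFin (λ y → fromBool (h y)) x) ⟩
  toBool (fromBool (h x))                 ≡⟨ toBool-fromBool (h x) ⟩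
  h x                                     ∎
  where open ≡-Reasoning

-- Existential projection of a language over annotated letters

splitList : ∀ {A : Set} a b (t : List A) → length t ≡ a + b →
  Σ (List A) λ t₁ → Σ (List A) λ t₂ → t ≡ t₁ ++ t₂ × length t₁ ≡ a × length t₂ ≡ b
splitList zero b t l = [] , t , refl , refl , l
splitList (suc a) b (x ∷ t) l with splitList a b t (NP.suc-injective l)
... | t₁ , t₂ , refl , l₁ , l₂ = x ∷ t₁ , t₂ , refl , cong suc l₁ , l₂

length-++-≡ : ∀ {A : Set} {a b} (u w : List A) → length u ≡ a → length w ≡ b → length (u ++ w) ≡ a + b
length-++-≡ u w lu lw = trans (LP.length-++ u) (cong₂ _+_ lu lw)

module _ {Σ₁ Σ₂ : Set} (e : Σ₁ → Bool → Σ₂) where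

  annotate : List Σ₁ → List Bool → List Σ₂
  annotate = L.zipWith e

  annotate-++ : ∀ u w t₁ t₂ → length u ≡ length t₁ →
    annotate (u ++ w) (t₁ ++ t₂) ≡ annotate u t₁ ++ annotate w t₂
  annotate-++ [] w [] t₂ l = refl
  annotate-++ (a ∷ u) w (b ∷ t₁) t₂ l = cong (e a b ∷_) (annotate-++ u w t₁ t₂ (NP.suc-injective l))

  length-annotate : ∀ u t → length t ≡ length u → length (annotate u t) ≡ length u
  length-annotate [] t l = refl
  length-annotate (a ∷ u) (b ∷ t) l = cong suc (length-annotate u t (NP.suc-injective l))

  map-annotate : ∀ {C : Set} (g : Σ₂ → C) (g' : Σ₁ → C) → (∀ a b → g (e a b) ≡ g' a) →
    ∀ u t → length t ≡ length u → map g (annotate u t) ≡ map g' u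
  map-annotate g g' h [] t l = refl
  map-annotate g g' h (a ∷ u) (b ∷ t) l = cong₂ _∷_ (h a b) (map-annotate g g' h u t (NP.suc-injective l))

  map-annotate-bits : (g : Σ₂ → Bool) → (∀ a b → g (e a b) ≡ b) →
    ∀ u t → length t ≡ length u → map g (annotate u t) ≡ t
  map-annotate-bits g h [] [] l = refl
  map-annotate-bits g h (a ∷ u) (b ∷ t) l = cong₂ _∷_ (h a b) (map-annotate-bits g h u t (NP.suc-injective l))

  project : (List Σ₂ → Bool) → List Σ₁ → Bool
  project L u = anyBits (length u) (λ t → L (annotate u t))

  module _ {L : List Σ₂ → Bool} where

    project-++⁻ : ∀ {i p} u w → length u ≡ i → length w ≡ p → project L (u ++ w) ≡ true →
      Σ (List Bool) λ t₁ → Σ (List Bool) λ t₂ → length t₁ ≡ i × length t₂ ≡ p ×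
        L (annotate u t₁ ++ annotate w t₂) ≡ true
    project-++⁻ {i} {p} u w lu lw pr =
      let (t , lt , Lt) = anyBits-sound _ _ pr
          (t₁ , t₂ , t≡ , l₁ , l₂) = splitList i p t (trans lt (length-++-≡ u w lu lw))
      in t₁ , t₂ , l₁ , l₂ , trans (cong L (sym (annotate-++ u w t₁ t₂ (trans lu (sym l₁)))))
                                   (subst (λ z → L (annotate (u ++ w) z) ≡ true) t≡ Lt)

    project-++⁺ : ∀ u w t₁ t₂ → length t₁ ≡ length u → length t₂ ≡ length w →
      L (annotate u t₁ ++ annotate w t₂) ≡ true → project L (u ++ w) ≡ true
    project-++⁺ u w t₁ t₂ l₁ l₂ Lt =
      anyBits-complete _ _ (t₁ ++ t₂) (trans (length-++-≡ t₁ t₂ l₁ l₂) (sym (LP.length-++ u)))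
        (trans (cong L (annotate-++ u w t₁ t₂ (sym l₁))) Lt)

    module _ {K i p : ℕ} (c : List Σ₂ → Fin K)
             (c-refines : ∀ u v → length u ≡ i → length v ≡ i → c u ≡ c v → SameFuture L p u v) where

      colours : List Σ₁ → Fin K → Bool
      colours u j = anyBits i (λ t → c (annotate u t) ≟ᵇ j)

      project-coloursMono : ∀ u v w → length u ≡ i → length v ≡ i → length w ≡ p →
        (∀ j → colours u j ≡ true → colours v j ≡ true) →
        project L (u ++ w) ≡ true → project L (v ++ w) ≡ true
      project-coloursMono u v w lu lv lw u⊆v pr =
        let (t₁ , t₂ , l₁ , l₂ , Lu) = project-++⁻ u w lu lw pr
            j = c (annotate u t₁)
            (t₁' , l₁' , cj) = anyBits-sound i _
              (u⊆v j (anyBits-complete i (λ t → c (annotate u t) ≟ᵇ j) t₁ l₁ (≟ᵇ-refl j)))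
            same = c-refines (annotate v t₁') (annotate u t₁) (length-annotated v t₁' lv l₁')
                     (length-annotated u t₁ lu l₁) (≟ᵇ⇒≡ cj)
                     (annotate w t₂) (length-annotated w t₂ lw l₂)
        in project-++⁺ v w t₁' t₂ (trans l₁' (sym lv)) (trans l₂ (sym lw)) (trans same Lu)
        where
          length-annotated : ∀ {n} x t → length x ≡ n → length t ≡ n → length (annotate x t) ≡ n
          length-annotated x t lx lt = trans (length-annotate x t (trans lt (sym lx))) lx

  -- The colour of u is the set of colours of its annotations.
  refinedBoundedIndex-project : ∀ {L} → RefinedBoundedIndex L → RefinedBoundedIndex (project L)
  refinedBoundedIndex-project {L} (K , H) = 2 ^ K , λ i p →
    let (c , c-refines) = H i p ; C = colours {L} c c-refines in
    (λ u → encodeSubset (C u)) , λ u v lu lv eq w lw →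
      let same = encodeSubset-injective (C u) (C v) eq in
      ≡true-ext (project-coloursMono {L} c c-refines u v w lu lv lw (λ j x → trans (sym (same j)) x))
                (project-coloursMono {L} c c-refines v u w lv lu lw (λ j x → trans (same j) x))

firstTrue : List Bool → ℕ
firstTrue [] = 0
firstTrue (true ∷ t) = 0
firstTrue (false ∷ t) = suc (firstTrue t)

atLeastTwoTrue : List Bool → Bool
atLeastTwoTrue [] = false
atLeastTwoTrue (true ∷ t) = or t
atLeastTwoTrue (false ∷ t) = atLeastTwoTrue t

exactlyOneTrue : List Bool → Bool
exactlyOneTrue [] = false
exactlyOneTrue (true ∷ t) = not (or t)
exactlyOneTrue (false ∷ t) = exactlyOneTrue t

or-++ : ∀ u w → or (u ++ w) ≡ or u ∨ or w
or-++ [] w = refl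
or-++ (true ∷ u) w = refl
or-++ (false ∷ u) w = or-++ u w

not-∨ : ∀ a b → not (a ∨ b) ≡ not a ∧ not b
not-∨ true b = refl
not-∨ false b = refl

exactlyOneTrue-++ : ∀ u w → exactlyOneTrue (u ++ w) ≡
  (if or u then not (atLeastTwoTrue u) ∧ not (or w) else exactlyOneTrue w)
exactlyOneTrue-++ [] w = refl
exactlyOneTrue-++ (true ∷ u) w = trans (cong not (or-++ u w)) (not-∨ (or u) (or w))
exactlyOneTrue-++ (false ∷ u) w = exactlyOneTrue-++ u w

firstTrue-++ : ∀ u w → firstTrue (u ++ w) ≡ (if or u then firstTrue u else length u + firstTrue w)
firstTrue-++ [] w = refl
firstTrue-++ (true ∷ u) w = refl
firstTrue-++ (false ∷ u) w with or u | firstTrue-++ u w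
... | true | e = cong suc e
... | false | e = cong suc e

firstTrue<length : ∀ t → or t ≡ true → firstTrue t < length t
firstTrue<length (true ∷ t) _ = s≤s z≤n
firstTrue<length (false ∷ t) e = s≤s (firstTrue<length t e)

firstTrue≡length : ∀ t → or t ≡ false → firstTrue t ≡ length t
firstTrue≡length [] _ = refl
firstTrue≡length (false ∷ t) e = cong suc (firstTrue≡length t e)

exactlyOneTrue⇒or : ∀ t → exactlyOneTrue t ≡ true → or t ≡ true
exactlyOneTrue⇒or (true ∷ t) _ = refl
exactlyOneTrue⇒or (false ∷ t) e = exactlyOneTrue⇒or t e

indicator : ℕ → ℕ → List Bool
indicator zero p = []
indicator (suc n) zero = true ∷ L.replicate n false
indicator (suc n) (suc p) = false ∷ indicator n p

length-indicator : ∀ n p → length (indicator n p) ≡ n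
length-indicator zero p = refl
length-indicator (suc n) zero = cong suc (LP.length-replicate n)
length-indicator (suc n) (suc p) = cong suc (length-indicator n p)

or-replicate-false : ∀ n → or (L.replicate n false) ≡ false
or-replicate-false zero = refl
or-replicate-false (suc n) = or-replicate-false n

exactlyOneTrue-indicator : ∀ n p → p < n → exactlyOneTrue (indicator n p) ≡ true
exactlyOneTrue-indicator (suc n) zero _ = cong not (or-replicate-false n)
exactlyOneTrue-indicator (suc n) (suc p) (s≤s lt) = exactlyOneTrue-indicator n p lt

firstTrue-indicator : ∀ n p → p < n → firstTrue (indicator n p) ≡ p
firstTrue-indicator (suc n) zero _ = refl
firstTrue-indicator (suc n) (suc p) (s≤s lt) = cong suc (firstTrue-indicator n p lt)

anyBits-exactlyOneTrue : ∀ n (G : ℕ → Bool) →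
  anyBits n (λ t → exactlyOneTrue t ∧ G (firstTrue t)) ≡ anyBelow n G
anyBits-exactlyOneTrue n G = ≡true-ext
  (λ e → let (t , lt , e') = anyBits-sound n _ e in
    anyBelow-complete n G (firstTrue t)
      (subst (firstTrue t <_) lt (firstTrue<length t (exactlyOneTrue⇒or t (∧-trueˡ e'))))
      (∧-trueʳ {exactlyOneTrue t} e'))
  (λ e → let (p , lt , gp) = anyBelow-sound n G e in
    anyBits-complete n _ (indicator n p) (length-indicator n p)
      (∧-true (exactlyOneTrue-indicator n p lt) (trans (cong G (firstTrue-indicator n p lt)) gp)))

decodeBool₂ : Fin (2 * 2) → Bool × Bool
decodeBool₂ z = toBool (proj₁ (remQuot {2} 2 z)) , toBool (proj₂ (remQuot {2} 2 z))

decodeBool₂-combine : ∀ a b → decodeBool₂ (combine (fromBool a) (fromBool b)) ≡ (a , b)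
decodeBool₂-combine a b =
  trans (cong (λ xy → toBool (proj₁ xy) , toBool (proj₂ xy)) (FP.remQuot-combine {2} {2} (fromBool a) (fromBool b)))
        (cong₂ _,_ (toBool-fromBool a) (toBool-fromBool b))

refinedBoundedIndex-factorBool₂ : ∀ {Σ' : Set} (L : List Σ' → Bool) (a b : List Σ' → Bool)
  (h : Bool → Bool → List Σ' → Bool) → (∀ u w → L (u ++ w) ≡ h (a u) (b u) w) →
  RefinedBoundedIndex L
refinedBoundedIndex-factorBool₂ L a b h eq = refinedBoundedIndex-factor L (2 * 2) λ i p →
  (λ u → combine (fromBool (a u)) (fromBool (b u))) ,
  (λ z → let (x , y) = decodeBool₂ z in h x y) ,
  λ u w _ _ → trans (eq u w)
    (cong (λ xy → h (proj₁ xy) (proj₂ xy) w) (sym (decodeBool₂-combine (a u) (b u))))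

module _ {Σ' : Set} where

  refinedBoundedIndex-exactlyOneTrue : (mark : Σ' → Bool) →
    RefinedBoundedIndex (λ w → exactlyOneTrue (map mark w))
  refinedBoundedIndex-exactlyOneTrue mark = refinedBoundedIndex-factorBool₂ (λ w → exactlyOneTrue (map mark w))
    (λ u → or (map mark u)) (λ u → atLeastTwoTrue (map mark u))
    (λ x y w → if x then not y ∧ not (or (map mark w)) else exactlyOneTrue (map mark w))
    λ u w → trans (cong exactlyOneTrue (LP.map-++ mark u w)) (exactlyOneTrue-++ (map mark u) (map mark w))

  length-map² : ∀ (f g : Σ' → Bool) u → length (map f u) ≡ length (map g u)
  length-map² f g u = trans (LP.length-map f u) (sym (LP.length-map g u))

  firstTrueLeq : (Σ' → Bool) → (Σ' → Bool) → List Σ' → Bool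
  firstTrueLeq mx my w = firstTrue (map mx w) ≤ᵇ firstTrue (map my w)

  firstTrueLeq-++ : ∀ mx my u w → firstTrueLeq mx my (u ++ w) ≡
     (if or (map mx u) ∨ or (map my u) then firstTrueLeq mx my u else firstTrueLeq mx my w)
  firstTrueLeq-++ mx my u w
    rewrite LP.map-++ mx u w | LP.map-++ my u w
          | firstTrue-++ (map mx u) (map mx w) | firstTrue-++ (map my u) (map my w)
    with or (map mx u) in hx | or (map my u) in hy
  ... | true | true = refl
  ... | true | false = trans (≤⇒≤ᵇ-true (NP.≤-trans x≤|u| (NP.m≤m+n _ _)))
                             (sym (≤⇒≤ᵇ-true (NP.≤-trans x≤|u| (NP.≤-reflexive |u|≡y))))
    where
      x≤|u| : firstTrue (map mx u) ≤ length (map my u)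
      x≤|u| = NP.≤-trans (NP.<⇒≤ (firstTrue<length (map mx u) hx)) (NP.≤-reflexive (length-map² mx my u))
      |u|≡y : length (map my u) ≡ firstTrue (map my u)
      |u|≡y = sym (firstTrue≡length (map my u) hy)
  ... | false | true = trans (>⇒≤ᵇ-false (NP.<-≤-trans y<|u| (NP.m≤m+n _ _)))
                             (sym (>⇒≤ᵇ-false (NP.<-≤-trans y<|u| (NP.≤-reflexive |u|≡x))))
    where
      y<|u| : firstTrue (map my u) < length (map mx u)
      y<|u| = NP.<-≤-trans (firstTrue<length (map my u) hy) (NP.≤-reflexive (length-map² my mx u))
      |u|≡x : length (map mx u) ≡ firstTrue (map mx u)
      |u|≡x = sym (firstTrue≡length (map mx u) hx)
  ... | false | false =
    trans (cong (λ z → z + firstTrue (map mx w) ≤ᵇ length (map my u) + firstTrue (map my w))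
                (length-map² mx my u))
          (≤ᵇ-cancelˡ-+ (length (map my u)) _ _)

  refinedBoundedIndex-firstTrueLeq : (mx my : Σ' → Bool) → RefinedBoundedIndex (firstTrueLeq mx my)
  refinedBoundedIndex-firstTrueLeq mx my = refinedBoundedIndex-factorBool₂ (firstTrueLeq mx my)
    (λ u → or (map mx u) ∨ or (map my u)) (firstTrueLeq mx my)
    (λ x y w → if x then y else firstTrueLeq mx my w)
    (firstTrueLeq-++ mx my)

at : ∀ {A : Set} → List A → ℕ → Maybe A
at [] p = nothing
at (a ∷ w) zero = just a
at (a ∷ w) (suc p) = at w p

at-map : ∀ {A B : Set} (g : A → B) w p → at (map g w) p ≡ M.map g (at w p)
at-map g [] p = refl
at-map g (a ∷ w) zero = refl
at-map g (a ∷ w) (suc p) = at-map g w p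

maybe′-map : ∀ {A B C : Set} (f : A → B) (g : B → C) (c : C) d → M.maybe′ g c (M.map f d) ≡ M.maybe′ (λ a → g (f a)) c d
maybe′-map f g c nothing = refl
maybe′-map f g c (just a) = refl

at-length : ∀ {A : Set} (w : List A) → at w (length w) ≡ nothing
at-length [] = refl
at-length (a ∷ w) = at-length w

at-toℕ : ∀ {A : Set} (u : List A) (i : Fin (length u)) → at u (toℕ i) ≡ just (lookup u i)
at-toℕ (a ∷ u) F.zero = refl
at-toℕ (a ∷ u) (F.suc i) = at-toℕ u i

at-< : ∀ {A : Set} (u : List A) p → p < length u → Σ A λ a → at u p ≡ just a
at-< (a ∷ u) zero lt = a , refl
at-< (a ∷ u) (suc p) (s≤s lt) = at-< u p lt

-- A list of bits read as a set of positions; positions beyond its end are absent.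
bitAt : List Bool → ℕ → Bool
bitAt t p = M.fromMaybe false (at t p)

bitAt-map : ∀ {A : Set} (g : A → Bool) w p → bitAt (map g w) p ≡ M.maybe′ g false (at w p)
bitAt-map g w p = trans (cong (M.fromMaybe false) (at-map g w p)) (lemma (at w p))
  where
    lemma : ∀ d → M.fromMaybe false (M.map g d) ≡ M.maybe′ g false d
    lemma nothing = refl
    lemma (just a) = refl

bitAt-tabulate : ∀ {n} (X : Fin n → Bool) (p : Fin n) → bitAt (L.tabulate X) (toℕ p) ≡ X p
bitAt-tabulate {suc n} X F.zero = refl
bitAt-tabulate {suc n} X (F.suc p) = bitAt-tabulate (λ z → X (F.suc z)) p

bitAt-tabulate-toℕ : ∀ {n} (g : ℕ → Bool) p → p < n → bitAt (L.tabulate {n = n} (λ i → g (toℕ i))) p ≡ g p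
bitAt-tabulate-toℕ {n} g p lt = begin
  bitAt bits p                  ≡⟨ cong (bitAt bits) (FP.toℕ-fromℕ< lt) ⟨
  bitAt bits (toℕ (fromℕ< lt))  ≡⟨ bitAt-tabulate (λ i → g (toℕ i)) (fromℕ< lt) ⟩
  g (toℕ (fromℕ< lt))           ≡⟨ cong g (FP.toℕ-fromℕ< lt) ⟩
  g p                           ∎
  where
    open ≡-Reasoning
    bits = L.tabulate {n = n} (λ i → g (toℕ i))

module _ {Σ' : Set} (mark : Σ' → Bool) where

  shiftBy : ℕ → Maybe (ℕ × Σ') → Maybe (ℕ × Σ')
  shiftBy n = M.map (λ d → n + proj₁ d , proj₂ d)

  firstMarked : List Σ' → Maybe (ℕ × Σ')
  firstMarked [] = nothing
  firstMarked (a ∷ w) = if mark a then just (0 , a) else shiftBy 1 (firstMarked w)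

  firstMarked-++ : ∀ u w → firstMarked (u ++ w) ≡ (firstMarked u M.<∣> shiftBy (length u) (firstMarked w))
  firstMarked-++ [] w with firstMarked w
  ... | nothing = refl
  ... | just d = refl
  firstMarked-++ (a ∷ u) w with mark a
  ... | true = refl
  ... | false rewrite firstMarked-++ u w with firstMarked u
  ...   | just d = refl
  ...   | nothing with firstMarked w
  ...     | nothing = refl
  ...     | just d = refl

  firstMarked-just : ∀ w {p a} → firstMarked w ≡ just (p , a) → firstTrue (map mark w) ≡ p × at w p ≡ just a
  firstMarked-just (b ∷ w) e with mark b
  firstMarked-just (b ∷ w) refl | true = refl , refl
  firstMarked-just (b ∷ w) e | false with firstMarked w in e'
  firstMarked-just (b ∷ w) refl | false | just (q , c) =
    let (ft≡q , at≡c) = firstMarked-just w e' in cong suc ft≡q , at≡c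

  firstMarked-nothing : ∀ w → firstMarked w ≡ nothing → firstTrue (map mark w) ≡ length w
  firstMarked-nothing [] e = refl
  firstMarked-nothing (b ∷ w) e with mark b
  firstMarked-nothing (b ∷ w) () | true
  ... | false with firstMarked w in e'
  ...   | nothing = cong suc (firstMarked-nothing w e')

  -- Once the prefix contains the mark, the answer is already known: colours are nothing,
  -- just false and just true.
  refinedBoundedIndex-firstMarked : (G : ℕ → Maybe (ℕ × Σ') → Bool) →
    RefinedBoundedIndex (λ w → G (length w) (firstMarked w))
  refinedBoundedIndex-firstMarked G = refinedBoundedIndex-factor (λ w → G (length w) (firstMarked w)) 3 λ i p →
    (λ u → colour (i + p) (firstMarked u)) , resume (i + p) i , split i p
    where
      colour : ℕ → Maybe (ℕ × Σ') → Fin 3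
      colour n nothing = F.zero
      colour n (just d) = F.suc (fromBool (G n (just d)))
      resume : ℕ → ℕ → Fin 3 → List Σ' → Bool
      resume n i F.zero w = G n (shiftBy i (firstMarked w))
      resume n i (F.suc b) w = toBool b
      split : ∀ i p u w → length u ≡ i → length w ≡ p →
        G (length (u ++ w)) (firstMarked (u ++ w)) ≡ resume (i + p) i (colour (i + p) (firstMarked u)) w
      split i p u w refl refl rewrite LP.length-++ u {w} | firstMarked-++ u w with firstMarked u
      ... | nothing = refl
      ... | just d = sym (toBool-fromBool (G (length u + length w) (just d)))

  viaPosition : (ℕ → ℕ → Maybe Σ' → Bool) → ℕ → Maybe (ℕ × Σ') → Bool
  viaPosition F n nothing = F n n nothing
  viaPosition F n (just (p , a)) = F n p (just a)

  viaPosition-firstMarked : ∀ F w →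
    viaPosition F (length w) (firstMarked w) ≡ F (length w) (firstTrue (map mark w)) (at w (firstTrue (map mark w)))
  viaPosition-firstMarked F w with firstMarked w in e
  ... | just (p , a) = let (ft≡p , at≡a) = firstMarked-just w e in
    sym (cong₂ (F (length w)) ft≡p (trans (cong (at w) ft≡p) at≡a))
  ... | nothing = let ft≡n = firstMarked-nothing w e in
    sym (cong₂ (F (length w)) ft≡n (trans (cong (at w) ft≡n) (at-length w)))

  refinedBoundedIndex-atFirstMarked : (F : ℕ → ℕ → Maybe Σ' → Bool) →
    RefinedBoundedIndex (λ w → F (length w) (firstTrue (map mark w)) (at w (firstTrue (map mark w))))
  refinedBoundedIndex-atFirstMarked F =
    refinedBoundedIndex-resp (viaPosition-firstMarked F) (refinedBoundedIndex-firstMarked (viaPosition F))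

-- Boolean semantics of MSO

module Semantics {k ℓ : ℕ} (Ps : Fin ℓ → MonPred) where

  sat : ∀ {f s} → Formula k ℓ f s → List (Fin k) → (Fin f → ℕ) → (Fin s → ℕ → Bool) → Bool
  sat (letter a x) u ρ σ = M.maybe′ (_≟ᵇ a) false (at u (ρ x))
  sat (leq x y) u ρ σ = ρ x ≤ᵇ ρ y
  sat (pred j x) u ρ σ = Ps j (length u) (ρ x)
  sat (mem x X) u ρ σ = σ X (ρ x)
  sat (and φ ψ) u ρ σ = sat φ u ρ σ ∧ sat ψ u ρ σ
  sat (neg φ) u ρ σ = not (sat φ u ρ σ)
  sat (ex1 φ) u ρ σ = anyBelow (length u) (λ p → sat φ u (p VF.∷ ρ) σ)
  sat (ex2 φ) u ρ σ = anyBits (length u) (λ t → sat φ u ρ (bitAt t VF.∷ σ))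

  sat-cong : ∀ {f s} (φ : Formula k ℓ f s) u {ρ ρ' σ σ'} → (∀ x → ρ x ≡ ρ' x) →
    (∀ X p → σ X p ≡ σ' X p) → sat φ u ρ σ ≡ sat φ u ρ' σ'
  sat-cong (letter a x) u hρ hσ = cong (λ z → M.maybe′ (_≟ᵇ a) false (at u z)) (hρ x)
  sat-cong (leq x y) u hρ hσ = cong₂ _≤ᵇ_ (hρ x) (hρ y)
  sat-cong (pred j x) u hρ hσ = cong (Ps j (length u)) (hρ x)
  sat-cong (mem x X) u {ρ' = ρ'} {σ} hρ hσ = trans (cong (σ X) (hρ x)) (hσ X (ρ' x))
  sat-cong (and φ ψ) u hρ hσ = cong₂ _∧_ (sat-cong φ u hρ hσ) (sat-cong ψ u hρ hσ)
  sat-cong (neg φ) u hρ hσ = cong not (sat-cong φ u hρ hσ)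
  sat-cong (ex1 φ) u hρ hσ = anyBelow-cong (length u) _ _ λ p _ →
    sat-cong φ u (λ { F.zero → refl ; (F.suc x) → hρ x }) hσ
  sat-cong (ex2 φ) u hρ hσ = anyBits-cong (length u) _ _ λ t _ →
    sat-cong φ u hρ (λ { F.zero p → refl ; (F.suc X) p → hσ X p })

  Sat⇔sat : ∀ {f s} (φ : Formula k ℓ f s) (u : List (Fin k)) {ρ σ} {ρ' : Fin f → ℕ} {σ' : Fin s → ℕ → Bool} →
    (∀ x → ρ' x ≡ toℕ (ρ x)) → (∀ X p → σ' X (toℕ p) ≡ σ X p) →
    Sat u Ps φ ρ σ ⇔ (sat φ u ρ' σ' ≡ true)
  Sat⇔sat (letter a x) u {ρ} hρ hσ rewrite hρ x | at-toℕ u (ρ x) =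
    mk⇔ (λ e → trans (cong (lookup u (ρ x) ≟ᵇ_) (sym e)) (≟ᵇ-refl _)) ≟ᵇ⇒≡
  Sat⇔sat (leq x y) u hρ hσ rewrite hρ x | hρ y = mk⇔ ≤⇒≤ᵇ-true ≤ᵇ-true⇒≤
  Sat⇔sat (pred j x) u hρ hσ rewrite hρ x = mk⇔ (λ e → e) (λ e → e)
  Sat⇔sat (mem x X) u {ρ} hρ hσ rewrite hρ x | hσ X (ρ x) = mk⇔ (λ e → e) (λ e → e)
  Sat⇔sat (and φ ψ) u {ρ' = ρ'} {σ'} hρ hσ =
    let ih₁ = Sat⇔sat φ u hρ hσ ; ih₂ = Sat⇔sat ψ u hρ hσ in
    mk⇔ (λ (s₁ , s₂) → ∧-true (Equivalence.to ih₁ s₁) (Equivalence.to ih₂ s₂))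
        (λ e → Equivalence.from ih₁ (∧-trueˡ e) , Equivalence.from ih₂ (∧-trueʳ {sat φ u ρ' σ'} e))
  Sat⇔sat (neg φ) u {ρ' = ρ'} {σ'} hρ hσ =
    let ih = Sat⇔sat φ u hρ hσ in
    mk⇔ (λ ¬S → [ (λ e → ⊥-elim (¬S (Equivalence.from ih e))) , not-true ]′ (true-or-false (sat φ u ρ' σ')))
        (λ e S → false≢true (not-true⁻ e) (Equivalence.to ih S))
  Sat⇔sat (ex1 φ) u {ρ} {σ} {ρ'} hρ hσ = mk⇔
    (λ (p , S) → anyBelow-complete (length u) _ (toℕ p) (FP.toℕ<n p)
       (Equivalence.to (Sat⇔sat φ u {p VF.∷ ρ} {σ} {toℕ p VF.∷ ρ'} (λ { F.zero → refl ; (F.suc x) → hρ x }) hσ) S))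
    (λ e → let (p , lt , sp) = anyBelow-sound (length u) _ e in
       fromℕ< lt , Equivalence.from (Sat⇔sat φ u {fromℕ< lt VF.∷ ρ} {σ} {p VF.∷ ρ'}
          (λ { F.zero → sym (FP.toℕ-fromℕ< lt) ; (F.suc x) → hρ x }) hσ) sp)
  Sat⇔sat (ex2 φ) u {ρ} {σ} {ρ'} {σ'} hρ hσ = mk⇔
    (λ (X , S) → anyBits-complete (length u) _ (L.tabulate X) (LP.length-tabulate X)
       (Equivalence.to (Sat⇔sat φ u {ρ} {X VF.∷ σ} {ρ'} {bitAt (L.tabulate X) VF.∷ σ'} hρ
          (λ { F.zero p → bitAt-tabulate X p ; (F.suc Y) p → hσ Y p })) S))
    (λ e → let (t , lt , st) = anyBits-sound (length u) _ e
               X = λ p → bitAt t (toℕ p) in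
       X , Equivalence.from (Sat⇔sat φ u {ρ} {X VF.∷ σ} {ρ'} {bitAt t VF.∷ σ'} hρ
          (λ { F.zero p → refl ; (F.suc Y) p → hσ Y p })) st)

module Annotated {k ℓ : ℕ} (Ps : Fin ℓ → MonPred) where
  open Semantics {k} {ℓ} Ps

  Letter : ℕ → ℕ → Set
  Letter f s = Fin k × (Fin f → Bool) × (Fin s → Bool)

  letters : ∀ {f s} → List (Letter f s) → List (Fin k)
  letters = map proj₁

  foMark : ∀ {f s} → Fin f → Letter f s → Bool
  foMark x l = proj₁ (proj₂ l) x

  soMark : ∀ {f s} → Fin s → Letter f s → Bool
  soMark X l = proj₂ (proj₂ l) X

  -- A first-order variable denotes the first position marked for it (the length if there is none).
  foValuation : ∀ {f s} → List (Letter f s) → Fin f → ℕ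
  foValuation w x = firstTrue (map (foMark x) w)

  soValuation : ∀ {f s} → List (Letter f s) → Fin s → ℕ → Bool
  soValuation w X = bitAt (map (soMark X) w)

  ⟦_⟧ : ∀ {f s} → Formula k ℓ f s → List (Letter f s) → Bool
  ⟦ φ ⟧ w = sat φ (letters w) (foValuation w) (soValuation w)

  extendFO : ∀ {f s} → Letter f s → Bool → Letter (suc f) s
  extendFO (a , F' , S) b = (a , b VF.∷ F' , S)

  extendSO : ∀ {f s} → Letter f s → Bool → Letter f (suc s)
  extendSO (a , F' , S) b = (a , F' , b VF.∷ S)

  ⟦⟧-annotateFO : ∀ {f s} (φ : Formula k ℓ (suc f) s) w t → length t ≡ length w →
    ⟦ φ ⟧ (annotate extendFO w t) ≡ sat φ (letters w) (firstTrue t VF.∷ foValuation w) (soValuation w)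
  ⟦⟧-annotateFO φ w t lt =
    trans (cong (λ u → sat φ u (foValuation (annotate extendFO w t)) (soValuation (annotate extendFO w t)))
                 (map-annotate extendFO proj₁ proj₁ (λ _ _ → refl) w t lt))
      (sat-cong φ (letters w)
         (λ { F.zero → cong firstTrue (map-annotate-bits extendFO (foMark F.zero) (λ _ _ → refl) w t lt)
            ; (F.suc x) → cong firstTrue (map-annotate extendFO (foMark (F.suc x)) (foMark x) (λ _ _ → refl) w t lt) })
         (λ X p → cong (λ z → bitAt z p) (map-annotate extendFO (soMark X) (soMark X) (λ _ _ → refl) w t lt)))

  ⟦⟧-annotateSO : ∀ {f s} (φ : Formula k ℓ f (suc s)) w t → length t ≡ length w →
    ⟦ φ ⟧ (annotate extendSO w t) ≡ sat φ (letters w) (foValuation w) (bitAt t VF.∷ soValuation w)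
  ⟦⟧-annotateSO φ w t lt =
    trans (cong (λ u → sat φ u (foValuation (annotate extendSO w t)) (soValuation (annotate extendSO w t)))
                 (map-annotate extendSO proj₁ proj₁ (λ _ _ → refl) w t lt))
      (sat-cong φ (letters w)
         (λ x → cong firstTrue (map-annotate extendSO (foMark x) (foMark x) (λ _ _ → refl) w t lt))
         (λ { F.zero p → cong (λ z → bitAt z p) (map-annotate-bits extendSO (soMark F.zero) (λ _ _ → refl) w t lt)
            ; (F.suc X) p → cong (λ z → bitAt z p)
                              (map-annotate extendSO (soMark (F.suc X)) (soMark X) (λ _ _ → refl) w t lt) }))

  ⟦ex1⟧-project : ∀ {f s} (φ : Formula k ℓ (suc f) s) w →
    project extendFO (λ w' → exactlyOneTrue (map (foMark F.zero) w') ∧ ⟦ φ ⟧ w') w ≡ ⟦ ex1 φ ⟧ w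
  ⟦ex1⟧-project φ w = begin
    anyBits (length w) (λ t → exactlyOneTrue (map (foMark F.zero) (annotate extendFO w t))
                              ∧ ⟦ φ ⟧ (annotate extendFO w t))
      ≡⟨ anyBits-cong (length w) _ _ (λ t lt →
           cong₂ _∧_ (cong exactlyOneTrue (map-annotate-bits extendFO (foMark F.zero) (λ _ _ → refl) w t lt))
                     (⟦⟧-annotateFO φ w t lt)) ⟩
    anyBits (length w) (λ t → exactlyOneTrue t ∧ G (firstTrue t))
      ≡⟨ anyBits-exactlyOneTrue (length w) G ⟩
    anyBelow (length w) G
      ≡⟨ cong (λ n → anyBelow n G) (LP.length-map proj₁ w) ⟨
    ⟦ ex1 φ ⟧ w ∎
    where
      open ≡-Reasoning
      G = λ p → sat φ (letters w) (p VF.∷ foValuation w) (soValuation w)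

  ⟦ex2⟧-project : ∀ {f s} (φ : Formula k ℓ f (suc s)) w → project extendSO ⟦ φ ⟧ w ≡ ⟦ ex2 φ ⟧ w
  ⟦ex2⟧-project φ w =
    trans (anyBits-cong (length w) _ _ (⟦⟧-annotateSO φ w))
          (cong (λ n → anyBits n (λ t → sat φ (letters w) (foValuation w) (bitAt t VF.∷ soValuation w)))
                (sym (LP.length-map proj₁ w)))

  refinedBoundedIndex-⟦⟧ : ∀ {f s} (φ : Formula k ℓ f s) → RefinedBoundedIndex ⟦ φ ⟧
  refinedBoundedIndex-⟦⟧ (letter a x) = refinedBoundedIndex-resp
    (λ w → sym (trans (cong (M.maybe′ (_≟ᵇ a) false) (at-map proj₁ w (foValuation w x)))
                 (maybe′-map proj₁ (_≟ᵇ a) false (at w (foValuation w x)))))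
    (refinedBoundedIndex-atFirstMarked (foMark x) (λ _ _ d → M.maybe′ (λ l → proj₁ l ≟ᵇ a) false d))
  refinedBoundedIndex-⟦⟧ (leq x y) = refinedBoundedIndex-firstTrueLeq (foMark x) (foMark y)
  refinedBoundedIndex-⟦⟧ (pred j x) = refinedBoundedIndex-resp
    (λ w → cong (λ n → Ps j n (foValuation w x)) (sym (LP.length-map proj₁ w)))
    (refinedBoundedIndex-atFirstMarked (foMark x) (λ n p _ → Ps j n p))
  refinedBoundedIndex-⟦⟧ (mem x X) = refinedBoundedIndex-resp
    (λ w → sym (bitAt-map (soMark X) w (foValuation w x)))
    (refinedBoundedIndex-atFirstMarked (foMark x) (λ _ _ → M.maybe′ (soMark X) false))
  refinedBoundedIndex-⟦⟧ (and φ ψ) =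
    refinedBoundedIndex-zipWith _∧_ {⟦ φ ⟧} {⟦ ψ ⟧} (refinedBoundedIndex-⟦⟧ φ) (refinedBoundedIndex-⟦⟧ ψ)
  refinedBoundedIndex-⟦⟧ (neg φ) =
    refinedBoundedIndex-zipWith (λ a _ → not a) {⟦ φ ⟧} {⟦ φ ⟧} (refinedBoundedIndex-⟦⟧ φ) (refinedBoundedIndex-⟦⟧ φ)
  refinedBoundedIndex-⟦⟧ (ex1 φ) = refinedBoundedIndex-resp (⟦ex1⟧-project φ)
    (refinedBoundedIndex-project extendFO {λ w → exactlyOneTrue (map (foMark F.zero) w) ∧ ⟦ φ ⟧ w}
      (refinedBoundedIndex-zipWith _∧_ {λ w → exactlyOneTrue (map (foMark F.zero) w)} {⟦ φ ⟧}
        (refinedBoundedIndex-exactlyOneTrue (foMark F.zero)) (refinedBoundedIndex-⟦⟧ φ)))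
  refinedBoundedIndex-⟦⟧ (ex2 φ) =
    refinedBoundedIndex-resp (⟦ex2⟧-project φ) (refinedBoundedIndex-project extendSO {⟦ φ ⟧} (refinedBoundedIndex-⟦⟧ φ))

msoDefinable⇒refinedBoundedIndex : ∀ {k} (L : Language k) → MSODefinable L → RefinedBoundedIndex L
msoDefinable⇒refinedBoundedIndex {k} L (ℓ , φ , Ps , L⇔φ) =
  refinedBoundedIndex-resp ⟦φ⟧-unannotated (refinedBoundedIndex-map unannotated {⟦ φ ⟧} (refinedBoundedIndex-⟦⟧ φ))
  where
    open Semantics {k} {ℓ} Ps
    open Annotated {k} {ℓ} Ps
    unannotated : Fin k → Letter 0 0
    unannotated a = (a , (λ ()) , (λ ()))
    letters-unannotated : ∀ u → letters (map unannotated u) ≡ u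
    letters-unannotated [] = refl
    letters-unannotated (a ∷ u) = cong (a ∷_) (letters-unannotated u)
    ⟦φ⟧-unannotated : ∀ u → ⟦ φ ⟧ (map unannotated u) ≡ L u
    ⟦φ⟧-unannotated u =
      let Models⇔sat = Sat⇔sat φ u {ρ' = λ ()} {σ' = λ ()} (λ ()) (λ ()) in
      trans (sat-cong φ (letters (map unannotated u)) {σ' = λ ()} (λ ()) (λ ()))
      (trans (cong (λ z → sat φ z (λ ()) (λ ())) (letters-unannotated u))
        (≡true-ext (λ e → Equivalence.from (L⇔φ u) (Equivalence.from Models⇔sat e))
                   (λ e → Equivalence.to Models⇔sat (Equivalence.to (L⇔φ u) e))))

-- From a refining colouring to an exact count of classes

module Words (k : ℕ) where

  anyWord : ℕ → (Word k → Bool) → Bool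
  anyWord = anyOfLength (λ a → a)

  anyWord-sound : ∀ i g → anyWord i g ≡ true → Σ (Word k) λ v → length v ≡ i × g v ≡ true
  anyWord-sound = anyOfLength-sound (λ a → a)

  anyWord-complete : ∀ i g v → length v ≡ i → g v ≡ true → anyWord i g ≡ true
  anyWord-complete = anyOfLength-complete (λ a → a) (λ a → a , refl)

  anyWord-cong : ∀ i g h → (∀ v → length v ≡ i → g v ≡ h v) → anyWord i g ≡ anyWord i h
  anyWord-cong = anyOfLength-cong (λ a → a) (λ a → a , refl)

  findWord : ℕ → (Word k → Bool) → Maybe (Word k)
  findWord = findOfLength (λ a → a)

  findWord-sound : ∀ i g {v} → findWord i g ≡ just v → length v ≡ i × g v ≡ true
  findWord-sound = findOfLength-sound (λ a → a)

  findWord-complete : ∀ i g v → length v ≡ i → g v ≡ true → Σ (Word k) λ v' → findWord i g ≡ just v'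
  findWord-complete = findOfLength-complete (λ a → a) (λ a → a , refl)

module _ {k : ℕ} (L : Language k) where
  open Words k

  sameFuture? : ℕ → Word k → Word k → Bool
  sameFuture? p u v = not (anyWord p (λ w → not (L (u ++ w) == L (v ++ w))))

  sameFuture?-sound : ∀ p u v → sameFuture? p u v ≡ true → SameFuture L p u v
  sameFuture?-sound p u v e w lw with true-or-false (L (u ++ w) == L (v ++ w))
  ... | inj₁ x = ==⇒≡ x
  ... | inj₂ x = ⊥-elim (false≢true (not-true⁻ e) (anyWord-complete p _ w lw (not-true x)))

  sameFuture?-complete : ∀ p u v → SameFuture L p u v → sameFuture? p u v ≡ true
  sameFuture?-complete p u v same with true-or-false (anyWord p (λ w → not (L (u ++ w) == L (v ++ w))))
  ... | inj₂ x = not-true x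
  ... | inj₁ x = let (w , lw , differ) = anyWord-sound p _ x in
    ⊥-elim (false≢true (not-true⁻ differ)
      (trans (cong (L (u ++ w) ==_) (sym (same w lw))) (==-refl (L (u ++ w)))))

  SameFuture-trans : ∀ {p u v x} → SameFuture L p u v → SameFuture L p v x → SameFuture L p u x
  SameFuture-trans s₁ s₂ w lw = trans (s₁ w lw) (s₂ w lw)

  SameFuture-sym : ∀ {p u v} → SameFuture L p u v → SameFuture L p v u
  SameFuture-sym s w lw = sym (s w lw)

  SameFuture⇒Sim : ∀ {p u v} → SameFuture L p u v → Sim L p u v
  SameFuture⇒Sim s w lw = mk⇔ (trans (sym (s w lw))) (trans (s w lw))

  Sim⇒SameFuture : ∀ {p u v} → Sim L p u v → SameFuture L p u v
  Sim⇒SameFuture s w lw = ≡true-ext (Equivalence.to (s w lw)) (Equivalence.from (s w lw))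

  -- The exact colour of u is the least colour of a word of length i with the same future as u.
  module Canonical {K : ℕ} (i p : ℕ) (c : Word k → Fin K)
                   (c-refines : ∀ u v → length u ≡ i → length v ≡ i → c u ≡ c v → SameFuture L p u v) where

    hasColourOfClass : Word k → Fin K → Bool
    hasColourOfClass u j = anyWord i (λ v → (c v ≟ᵇ j) ∧ sameFuture? p u v)

    leastColour : Word k → Maybe (Fin K)
    leastColour u = firstJust K (λ j → if hasColourOfClass u j then just j else nothing)

    canonical : Word k → Fin (suc K)
    canonical u = M.maybe′ F.suc F.zero (leastColour u)

    leastColour-defined : ∀ u → length u ≡ i → Σ (Fin K) λ j → leastColour u ≡ just j × hasColourOfClass u j ≡ true
    leastColour-defined u lu =
      let own = anyWord-complete i _ u lu (∧-true (≟ᵇ-refl (c u)) (sameFuture?-complete p u u (λ _ _ → refl)))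
          (j , ej) = firstJust-complete K _ (c u) (cong (λ b → if b then just (c u) else nothing) own)
          (j' , ej') = firstJust-sound K _ ej
      in j , ej , chosen j' j ej'
      where
        chosen : ∀ j' j → (if hasColourOfClass u j' then just j' else nothing) ≡ just j → hasColourOfClass u j ≡ true
        chosen j' j e with hasColourOfClass u j' in eh
        chosen j' j refl | true = eh

    leastColour⇒SameFuture : ∀ u v j → hasColourOfClass u j ≡ true → hasColourOfClass v j ≡ true →
      SameFuture L p u v
    leastColour⇒SameFuture u v j hu hv =
      let (u' , lu' , eu) = anyWord-sound i _ hu
          (v' , lv' , ev) = anyWord-sound i _ hv
          u'∼v' = c-refines u' v' lu' lv' (trans (≟ᵇ⇒≡ (∧-trueˡ eu)) (sym (≟ᵇ⇒≡ (∧-trueˡ ev))))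
      in SameFuture-trans (sameFuture?-sound p u u' (∧-trueʳ {c u' ≟ᵇ j} eu))
           (SameFuture-trans u'∼v' (SameFuture-sym (sameFuture?-sound p v v' (∧-trueʳ {c v' ≟ᵇ j} ev))))

    canonical-correct : ∀ u v → length u ≡ i → length v ≡ i → (canonical u ≡ canonical v) ⇔ Sim L p u v
    canonical-correct u v lu lv = mk⇔
      (λ same → let (ju , eu , hu) = leastColour-defined u lu ; (jv , ev , hv) = leastColour-defined v lv
                    ju≡jv = FP.suc-injective (trans (cong (M.maybe′ F.suc F.zero) (sym eu))
                                               (trans same (cong (M.maybe′ F.suc F.zero) ev)))
                in SameFuture⇒Sim (leastColour⇒SameFuture u v ju hu (subst (λ j → hasColourOfClass v j ≡ true) (sym ju≡jv) hv)))
      (λ u∼v → let same = Sim⇒SameFuture u∼v in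
        cong (M.maybe′ F.suc F.zero) (firstJust-cong K _ _ λ j →
          cong (λ b → if b then just j else nothing) (anyWord-cong i _ _ λ v' _ → cong ((c v' ≟ᵇ j) ∧_)
            (≡true-ext (λ e → sameFuture?-complete p v v' (SameFuture-trans (SameFuture-sym same) (sameFuture?-sound p u v' e)))
                       (λ e → sameFuture?-complete p u v' (SameFuture-trans same (sameFuture?-sound p v v' e)))))))

  refinedBoundedIndex⇒boundedIndex : RefinedBoundedIndex L → BoundedIndex L
  refinedBoundedIndex⇒boundedIndex (K , H) = suc K , λ i p →
    let (c , c-refines) = H i p ; open Canonical i p c c-refines in canonical , canonical-correct

-- Automata with advice

module NAutomatonRuns {k : ℕ} (A : NAutomaton k) where
  open NAutomaton A

  AcceptsFrom : ℕ → ℕ → Fin m → List (Fin k) → Set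
  AcceptsFrom i n q [] = Fin' n q ≡ true
  AcceptsFrom i n q (a ∷ w) = Σ (Fin m) λ q' → δ i n q a q' ≡ true × AcceptsFrom (suc i) n q' w

  RunFrom : ℕ → ℕ → Fin m → List (Fin k) → Set
  RunFrom i n q w = Σ (Fin (suc (length w)) → Fin m) λ r → r F.zero ≡ q ×
    (∀ (j : Fin (length w)) → δ (i + toℕ j) n (r (inject₁ j)) (lookup w j) (r (F.suc j)) ≡ true) ×
    Fin' n (r (fromℕ (length w))) ≡ true

  RunFrom⇒AcceptsFrom : ∀ i n q w → RunFrom i n q w → AcceptsFrom i n q w
  RunFrom⇒AcceptsFrom i n q [] (r , refl , _ , final) = final
  RunFrom⇒AcceptsFrom i n q (a ∷ w) (r , refl , steps , final) =
    r (F.suc F.zero) ,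
    subst (λ j → δ j n q a (r (F.suc F.zero)) ≡ true) (NP.+-identityʳ i) (steps F.zero) ,
    RunFrom⇒AcceptsFrom (suc i) n _ w
      ((λ j → r (F.suc j)) , refl ,
       (λ j → subst (λ z → δ z n (r (F.suc (inject₁ j))) (lookup w j) (r (F.suc (F.suc j))) ≡ true)
                    (NP.+-suc i (toℕ j)) (steps (F.suc j))) ,
       final)

  AcceptsFrom⇒RunFrom : ∀ i n q w → AcceptsFrom i n q w → RunFrom i n q w
  AcceptsFrom⇒RunFrom i n q [] final = (λ _ → q) , refl , (λ ()) , final
  AcceptsFrom⇒RunFrom i n q (a ∷ w) (q' , step , acc) =
    let (r , r₀ , steps , final) = AcceptsFrom⇒RunFrom (suc i) n q' w acc in
    (λ { F.zero → q ; (F.suc j) → r j }) , refl ,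
    (λ { F.zero → subst (λ z → δ z n q a (r F.zero) ≡ true) (sym (NP.+-identityʳ i))
                    (subst (λ z → δ i n q a z ≡ true) (sym r₀) step)
       ; (F.suc j) → subst (λ z → δ z n (r (inject₁ j)) (lookup w j) (r (F.suc j)) ≡ true)
                    (sym (NP.+-suc i (toℕ j))) (steps j) }) ,
    final

  NAccepts⇔AcceptsFrom : ∀ u → NAccepts A u ⇔ AcceptsFrom 0 (length u) q₀ u
  NAccepts⇔AcceptsFrom u = mk⇔ (RunFrom⇒AcceptsFrom 0 (length u) q₀ u) (AcceptsFrom⇒RunFrom 0 (length u) q₀ u)

module DAutomatonRuns {k : ℕ} (D : DAutomaton k) where
  open DAutomaton D
  open NAutomatonRuns (DtoN D)

  runFrom : ℕ → ℕ → Fin m → List (Fin k) → Fin m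
  runFrom i n q [] = q
  runFrom i n q (a ∷ w) = runFrom (suc i) n (δ i n q a) w

  AcceptsFrom⇔final : ∀ i n q w → AcceptsFrom i n q w ⇔ (Fin' n (runFrom i n q w) ≡ true)
  AcceptsFrom⇔final i n q [] = mk⇔ (λ e → e) (λ e → e)
  AcceptsFrom⇔final i n q (a ∷ w) = mk⇔
    (λ (q' , step , acc) → subst (λ z → Fin' n (runFrom (suc i) n z w) ≡ true) (sym (≟ᵇ⇒≡ step))
                             (Equivalence.to (AcceptsFrom⇔final (suc i) n q' w) acc))
    (λ e → δ i n q a , ≟ᵇ-refl (δ i n q a) , Equivalence.from (AcceptsFrom⇔final (suc i) n _ w) e)

  DAccepts⇔final : ∀ u → NAccepts (DtoN D) u ⇔ (Fin' (length u) (runFrom 0 (length u) q₀ u) ≡ true)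
  DAccepts⇔final u = mk⇔
    (λ x → Equivalence.to (AcceptsFrom⇔final 0 _ q₀ u) (Equivalence.to (NAccepts⇔AcceptsFrom u) x))
    (λ x → Equivalence.from (NAccepts⇔AcceptsFrom u) (Equivalence.from (AcceptsFrom⇔final 0 _ q₀ u) x))

dRecognizable⇒nRecognizable : ∀ {k} (L : Language k) → DRecognizable L → NRecognizable L
dRecognizable⇒nRecognizable L (D , L⇔D) = DtoN D , L⇔D

SameFuture-snoc : ∀ {k} (L : Language k) p x y a → SameFuture L (suc p) x y →
  SameFuture L p (x ++ a ∷ []) (y ++ a ∷ [])
SameFuture-snoc L p x y a same w lw = begin
  L ((x ++ a ∷ []) ++ w)   ≡⟨ cong L (LP.++-assoc x (a ∷ []) w) ⟩
  L (x ++ a ∷ w)           ≡⟨ same (a ∷ w) (cong suc lw) ⟩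
  L (y ++ a ∷ w)           ≡⟨ cong L (LP.++-assoc y (a ∷ []) w) ⟨
  L ((y ++ a ∷ []) ++ w)   ∎
  where open ≡-Reasoning

length-snoc : ∀ {A : Set} {i} (x : List A) a → length x ≡ i → length (x ++ a ∷ []) ≡ suc i
length-snoc {i = i} x a lx = trans (length-++-≡ x (a ∷ []) lx refl) (NP.+-comm i 1)

-- After reading i letters of a word of length n, the state is the ∼_{L,n−i}-class of the
-- prefix, and the transition reads the letter after a representative of that class.
module ClassAutomaton {k : ℕ} (L : Language k) (K : ℕ)
  (H : ∀ (i p : ℕ) → Σ (Word k → Fin K) λ c →
       ∀ (u v : Word k) → length u ≡ i → length v ≡ i → (c u ≡ c v) ⇔ Sim L p u v) where
  open Words k

  class : ℕ → ℕ → Word k → Fin K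
  class i p = proj₁ (H i p)

  representative : ℕ → ℕ → Fin K → Word k
  representative zero p q = []
  representative (suc i) p q = fromMaybe [] (findWord (suc i) (λ v → class (suc i) p v ≟ᵇ q))

  step : ℕ → ℕ → Fin K → Fin k → Fin K
  step i n q a = class (suc i) (n ∸ suc i) (representative i (n ∸ i) q ++ a ∷ [])

  automaton : DAutomaton k
  automaton = record { m = K ; q₀ = class 0 0 [] ; δ = step ; Fin' = λ n q → L (representative n 0 q) }

  Represents : ℕ → ℕ → Fin K → Word k → Set
  Represents i p q x = length (representative i p q) ≡ i × SameFuture L p (representative i p q) x

  Represents-snoc : ∀ i p q x a → Represents i (suc p) q x →
    Represents (suc i) p (class (suc i) p (representative i (suc p) q ++ a ∷ [])) (x ++ a ∷ [])
  Represents-snoc i p q x a (lr , r∼x) =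
    let r = representative i (suc p) q
        q' = class (suc i) p (r ++ a ∷ [])
        lra = length-snoc r a lr
        (v , ev) = findWord-complete (suc i) (λ v → class (suc i) p v ≟ᵇ q') (r ++ a ∷ []) lra (≟ᵇ-refl q')
        (lv , cv) = findWord-sound (suc i) (λ v → class (suc i) p v ≟ᵇ q') ev
        v∼ra = Sim⇒SameFuture L (Equivalence.to (proj₂ (H (suc i) p) v (r ++ a ∷ []) lv lra) (≟ᵇ⇒≡ cv))
    in subst (λ z → length z ≡ suc i × SameFuture L p z (x ++ a ∷ [])) (sym (cong (fromMaybe []) ev))
         (lv , SameFuture-trans L v∼ra (SameFuture-snoc L p r x a r∼x))

  open DAutomatonRuns automaton

  runFrom-represents : ∀ n y i q x → length x ≡ i → n ≡ i + length y → Represents i (length y) q x →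
    L (representative n 0 (runFrom i n q y)) ≡ L (x ++ y)
  runFrom-represents n [] i q x lx refl (lr , r∼x) rewrite NP.+-identityʳ i =
    trans (cong L (sym (LP.++-identityʳ (representative i 0 q)))) (r∼x [] refl)
  runFrom-represents n (a ∷ y) i q x lx n≡ r =
    let remaining : n ∸ i ≡ suc (length y)
        remaining = trans (cong (_∸ i) n≡) (NP.m+n∸m≡n i (suc (length y)))
        n≡' = trans n≡ (NP.+-suc i (length y))
        remaining' : n ∸ suc i ≡ length y
        remaining' = trans (cong (_∸ suc i) n≡') (NP.m+n∸m≡n (suc i) (length y))
        q' = class (suc i) (length y) (representative i (suc (length y)) q ++ a ∷ [])
        step≡ : step i n q a ≡ q'
        step≡ = cong₂ (λ p₁ p₂ → class (suc i) p₁ (representative i p₂ q ++ a ∷ [])) remaining' remaining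
    in trans (cong (λ z → L (representative n 0 (runFrom (suc i) n z y))) step≡)
         (trans (runFrom-represents n y (suc i) q' (x ++ a ∷ []) (length-snoc x a lx) n≡'
                   (Represents-snoc i (length y) q x a r))
                (cong L (LP.++-assoc x (a ∷ []) y)))

  correct : ∀ u → (L u ≡ true) ⇔ NAccepts (DtoN automaton) u
  correct u =
    let e = runFrom-represents (length u) u 0 (class 0 0 []) [] refl refl (refl , λ _ _ → refl) in
    mk⇔ (λ x → Equivalence.from (DAccepts⇔final u) (trans e x))
        (λ x → trans (sym e) (Equivalence.to (DAccepts⇔final u) x))

boundedIndex⇒dRecognizable : ∀ {k} (L : Language k) → BoundedIndex L → DRecognizable L
boundedIndex⇒dRecognizable L (K , H) = ClassAutomaton.automaton L K H , ClassAutomaton.correct L K H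

module Reachable {k : ℕ} (A : NAutomaton k) where
  open NAutomaton A
  open NAutomatonRuns A

  reachable : ℕ → ℕ → (Fin m → Bool) → List (Fin k) → Fin m → Bool
  reachable i n R [] = R
  reachable i n R (a ∷ w) = reachable (suc i) n (λ q' → anyFin m (λ q → R q ∧ δ i n q a q')) w

  AcceptsFromSome : ℕ → ℕ → (Fin m → Bool) → List (Fin k) → Set
  AcceptsFromSome i n R w = Σ (Fin m) λ q → R q ≡ true × AcceptsFrom i n q w

  AcceptsFromSome-reachable : ∀ i j n R u w → j ≡ i + length u →
    AcceptsFromSome i n R (u ++ w) ⇔ AcceptsFromSome j n (reachable i n R u) w
  AcceptsFromSome-reachable i j n R [] w refl rewrite NP.+-identityʳ i = mk⇔ (λ h → h) (λ h → h)
  AcceptsFromSome-reachable i j n R (a ∷ u) w j≡ =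
    let ih = AcceptsFromSome-reachable (suc i) j n (λ q' → anyFin m (λ q → R q ∧ δ i n q a q')) u w
               (trans j≡ (NP.+-suc i (length u))) in
    mk⇔ (λ (q , Rq , q' , step , acc) →
           Equivalence.to ih (q' , anyFin-complete m (λ q → R q ∧ δ i n q a q') q (∧-true Rq step) , acc))
        (λ h → let (q' , R'q' , acc) = Equivalence.from ih h
                   (q , e) = anyFin-sound m _ R'q'
               in q , ∧-trueˡ e , q' , ∧-trueʳ {R q} e , acc)

nRecognizable⇒refinedBoundedIndex : ∀ {k} (L : Language k) → NRecognizable L → RefinedBoundedIndex L
nRecognizable⇒refinedBoundedIndex L (A , L⇔A) = 2 ^ m , λ i p →
  (λ u → encodeSubset (reachedBy i p u)) , λ u v lu lv same w lw →
    let same-reached = encodeSubset-injective (reachedBy i p u) (reachedBy i p v) same in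
    ≡true-ext (λ e → let (q , r , acc) = Equivalence.to (accepts⇔ u lu w lw) e in
                     Equivalence.from (accepts⇔ v lv w lw) (q , trans (sym (same-reached q)) r , acc))
              (λ e → let (q , r , acc) = Equivalence.to (accepts⇔ v lv w lw) e in
                     Equivalence.from (accepts⇔ u lu w lw) (q , trans (same-reached q) r , acc))
  where
    open NAutomaton A
    open NAutomatonRuns A
    open Reachable A
    reachedBy : ℕ → ℕ → List _ → Fin m → Bool
    reachedBy i p = reachable 0 (i + p) (_≟ᵇ q₀)
    accepts⇔ : ∀ {i p} x → length x ≡ i → ∀ w → length w ≡ p →
      (L (x ++ w) ≡ true) ⇔ AcceptsFromSome i (i + p) (reachedBy i p x) w
    accepts⇔ {i} {p} x lx w lw =
      let n≡ = length-++-≡ x w lx lw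
          start = mk⇔ (λ acc → q₀ , ≟ᵇ-refl q₀ , acc)
                      (λ (q , q≡ , acc) → subst (λ z → AcceptsFrom 0 (i + p) z (x ++ w)) (≟ᵇ⇒≡ q≡) acc)
          fix-n = subst (λ n → NAccepts A (x ++ w) ⇔ AcceptsFrom 0 n q₀ (x ++ w)) n≡ (NAccepts⇔AcceptsFrom (x ++ w))
      in ⇔-trans (L⇔A (x ++ w))
           (⇔-trans fix-n
             (⇔-trans start (AcceptsFromSome-reachable 0 i (i + p) (_≟ᵇ q₀) x w (sym lx))))

module OneScanProducts {k : ℕ} (P : OneScan k) where
  open OneScan P
  open IsMonoid isMonoid using (assoc; identityˡ)

  scanFrom-++ : ∀ j n u w → scanFrom P j n (u ++ w) ≡ (scanFrom P j n u · scanFrom P (j + length u) n w)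
  scanFrom-++ j n [] w rewrite NP.+-identityʳ j = sym (identityˡ _)
  scanFrom-++ j n (a ∷ u) w = trans (cong (f j n a ·_) (trans (scanFrom-++ (suc j) n u w)
       (cong (λ z → scanFrom P (suc j) n u · scanFrom P z n w) (sym (NP.+-suc j (length u))))))
     (sym (assoc _ _ _))

oneScanRecognizable⇒refinedBoundedIndex : ∀ {k} (L : Language k) → OneScanRecognizable L → RefinedBoundedIndex L
oneScanRecognizable⇒refinedBoundedIndex L (P , L⇔P) = refinedBoundedIndex-factor L m λ i p →
  (λ u → scanFrom P 0 (i + p) u) , (λ z w → S (z · scanFrom P i (i + p) w)) ,
  λ u w lu lw → begin
    L (u ++ w)                                                       ≡⟨ ≡true-ext (Equivalence.to (L⇔P (u ++ w)))
                                                                                   (Equivalence.from (L⇔P (u ++ w))) ⟩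
    S (scanFrom P 0 (length (u ++ w)) (u ++ w))                      ≡⟨ cong (λ n → S (scanFrom P 0 n (u ++ w)))
                                                                                 (length-++-≡ u w lu lw) ⟩
    S (scanFrom P 0 (i + p) (u ++ w))                                ≡⟨ cong S (scanFrom-++ 0 (i + p) u w) ⟩
    S (scanFrom P 0 (i + p) u · scanFrom P (length u) (i + p) w)     ≡⟨ cong (λ j → S (scanFrom P 0 (i + p) u ·
                                                                                   scanFrom P j (i + p) w)) lu ⟩
    S (scanFrom P 0 (i + p) u · scanFrom P i (i + p) w)              ∎
  where
    open OneScan P
    open OneScanProducts P
    open ≡-Reasoning

-- One-scan programs

funToFin-cong : ∀ {a b} (f g : Fin a → Fin b) → (∀ x → f x ≡ g x) → funToFin f ≡ funToFin g
funToFin-cong {zero} f g h = refl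
funToFin-cong {suc a} f g h =
  cong₂ combine (h F.zero) (funToFin-cong (λ x → f (F.suc x)) (λ x → g (F.suc x)) (λ x → h (F.suc x)))

-- Self-maps of Fin M, coded as elements of Fin (M ^ M), under "first x, then y".
module TransformationMonoid (M : ℕ) where

  Transformation : Set
  Transformation = Fin (M ^ M)

  apply : Transformation → Fin M → Fin M
  apply = finToFun

  apply-funToFin : ∀ (f : Fin M → Fin M) x → apply (funToFin f) x ≡ f x
  apply-funToFin = FP.finToFun-funToFin

  _⨾_ : Transformation → Transformation → Transformation
  x ⨾ y = funToFin (λ s → apply y (apply x s))

  identity : Transformation
  identity = funToFin {M} {M} (λ s → s)

  ⨾-isMonoid : IsMonoid _≡_ _⨾_ identity
  ⨾-isMonoid = record
    { isSemigroup = record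
      { isMagma = record { isEquivalence = isEquivalence ; ∙-cong = cong₂ _⨾_ }
      ; assoc = λ x y z → trans
          (funToFin-cong _ _ (λ s → cong (apply z) (apply-funToFin (λ s' → apply y (apply x s')) s)))
          (sym (funToFin-cong _ _ (λ s → apply-funToFin (λ s' → apply z (apply y s')) (apply x s)))) }
    ; identity = (λ x → trans (funToFin-cong _ _ (λ s → cong (apply x) (apply-funToFin (λ s → s) s)))
                              (FP.funToFin-finToFin {M} {M} x))
               , (λ x → trans (funToFin-cong _ _ (λ s → apply-funToFin (λ s → s) (apply x s)))
                              (FP.funToFin-finToFin {M} {M} x)) }

≡ᵇ-true : ∀ m → (m ≡ᵇ m) ≡ true
≡ᵇ-true m = Equivalence.to T-≡ (NP.≡⇒≡ᵇ m m refl)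

≡ᵇ-true⇒≡ : ∀ {m n} → (m ≡ᵇ n) ≡ true → m ≡ n
≡ᵇ-true⇒≡ {m} {n} e = NP.≡ᵇ⇒≡ m n (Equivalence.from T-≡ e)

-- The automaton runs on the states of D together with two verdicts; the letter read at the
-- last position already moves to the verdict, because the final states depend on the length.
-- The empty word, whose product is the identity, has to be accepted separately.
module OneScanOfAutomaton {k : ℕ} (D : DAutomaton k) where
  open DAutomaton D
  open DAutomatonRuns D
  open TransformationMonoid (suc (suc m))

  State = Fin (suc (suc m))

  accept reject : State
  accept = F.zero
  reject = F.suc F.zero

  running : Fin m → State
  running q = F.suc (F.suc q)

  verdict : Bool → State
  verdict b = if b then accept else reject

  stepAt : ℕ → ℕ → Fin k → State → State
  stepAt i n a F.zero = accept
  stepAt i n a (F.suc F.zero) = reject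
  stepAt i n a (F.suc (F.suc q)) = if suc i ≡ᵇ n then verdict (Fin' n (δ i n q a)) else running (δ i n q a)

  accepting : Transformation → Bool
  accepting x = (apply x (running q₀) ≟ᵇ accept) ∨ ((x ≟ᵇ identity) ∧ Fin' 0 q₀)

  program : OneScan k
  program = record { m = suc (suc m) ^ suc (suc m) ; _·_ = _⨾_ ; e = identity ; isMonoid = ⨾-isMonoid
                   ; f = λ i n a → funToFin (stepAt i n a) ; S = accepting }

  runStates : ℕ → ℕ → List (Fin k) → State → State
  runStates j n [] s = s
  runStates j n (a ∷ w) s = runStates (suc j) n w (stepAt j n a s)

  apply-scanFrom : ∀ j n w s → apply (scanFrom program j n w) s ≡ runStates j n w s
  apply-scanFrom j n [] s = apply-funToFin (λ s → s) s
  apply-scanFrom j n (a ∷ w) s =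
    trans (apply-funToFin (λ s' → apply (scanFrom program (suc j) n w) (apply (funToFin (stepAt j n a)) s')) s)
      (trans (cong (apply (scanFrom program (suc j) n w)) (apply-funToFin (stepAt j n a) s))
        (apply-scanFrom (suc j) n w _))

  runStates-running : ∀ a w j n q → j + suc (length w) ≡ n →
    runStates j n (a ∷ w) (running q) ≡ verdict (Fin' n (runFrom j n q (a ∷ w)))
  runStates-running a [] j n q e
    rewrite trans (cong (suc j ≡ᵇ_) (sym (trans (NP.+-comm 1 j) e))) (≡ᵇ-true (suc j)) = refl
  runStates-running a (b ∷ w) j n q e with true-or-false (suc j ≡ᵇ n)
  ... | inj₁ last = ⊥-elim (NP.<-irrefl refl (begin-strict
          suc j                     <⟨ s≤s (s≤s (NP.m≤m+n j (length w))) ⟩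
          suc (suc (j + length w))  ≡⟨ cong suc (NP.+-suc j (length w)) ⟨
          suc (j + suc (length w))  ≡⟨ NP.+-suc j (suc (length w)) ⟨
          j + suc (suc (length w))  ≡⟨ trans e (sym (≡ᵇ-true⇒≡ last)) ⟩
          suc j                     ∎))
    where open NP.≤-Reasoning
  ... | inj₂ not-last rewrite not-last =
    runStates-running b w (suc j) n (δ j n q a) (trans (sym (NP.+-suc j (suc (length w)))) e)

  accepting-scanFrom : ∀ u → accepting (scanFrom program 0 (length u) u) ≡ Fin' (length u) (runFrom 0 (length u) q₀ u)
  accepting-scanFrom [] =
    cong₂ _∨_ (cong (_≟ᵇ accept) (apply-funToFin (λ s → s) (running q₀))) (cong (_∧ Fin' 0 q₀) (≟ᵇ-refl identity))
  accepting-scanFrom (a ∷ w) =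
    trans (cong₂ _∨_ (cong (_≟ᵇ accept) ends-in-verdict) (cong (_∧ Fin' 0 q₀) not-identity))
          (verdict-accept (Fin' (length (a ∷ w)) (runFrom 0 (length (a ∷ w)) q₀ (a ∷ w))))
    where
      x = scanFrom program 0 (length (a ∷ w)) (a ∷ w)
      ends-in-verdict : apply x (running q₀) ≡ verdict (Fin' (length (a ∷ w)) (runFrom 0 (length (a ∷ w)) q₀ (a ∷ w)))
      ends-in-verdict = trans (apply-scanFrom 0 _ (a ∷ w) (running q₀)) (runStates-running a w 0 _ q₀ refl)
      running≢verdict : ∀ b → running q₀ ≢ verdict b
      running≢verdict true ()
      running≢verdict false ()
      not-identity : (x ≟ᵇ identity) ≡ false
      not-identity with x F.≟ identity
      ... | no _ = refl
      ... | yes x≡id = ⊥-elim (running≢verdict _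
              (trans (sym (apply-funToFin (λ s → s) (running q₀))) (trans (cong (λ z → apply z (running q₀)) (sym x≡id)) ends-in-verdict)))
      verdict-accept : ∀ b → ((verdict b ≟ᵇ accept) ∨ false ∧ Fin' 0 q₀) ≡ b
      verdict-accept true = refl
      verdict-accept false = refl

  correct : ∀ {L : Language k} → (∀ u → (L u ≡ true) ⇔ NAccepts (DtoN D) u) →
    ∀ u → (L u ≡ true) ⇔ OAccepts program u
  correct L⇔D u = ⇔-trans (L⇔D u) (⇔-trans (DAccepts⇔final u)
    (mk⇔ (trans (accepting-scanFrom u)) (trans (sym (accepting-scanFrom u)))))

dRecognizable⇒oneScanRecognizable : ∀ {k} (L : Language k) → DRecognizable L → OneScanRecognizable L
dRecognizable⇒oneScanRecognizable L (D , L⇔D) = OneScanOfAutomaton.program D , OneScanOfAutomaton.correct D L⇔D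

module Connectives {k ℓ : ℕ} (Ps : Fin ℓ → MonPred) where
  open Semantics {k} {ℓ} Ps

  Form : ℕ → ℕ → Set
  Form f s = Formula k ℓ f s

  disj : ∀ {f s} → Form f s → Form f s → Form f s
  disj φ ψ = neg (and (neg φ) (neg ψ))

  impl : ∀ {f s} → Form f s → Form f s → Form f s
  impl φ ψ = neg (and φ (neg ψ))

  all1 : ∀ {f s} → Form (suc f) s → Form f s
  all1 φ = neg (ex1 (neg φ))

  conjAll : ∀ {f s} N → Form f s → (Fin N → Form f s) → Form f s
  conjAll zero truth g = truth
  conjAll (suc N) truth g = and (g F.zero) (conjAll N truth (λ t → g (F.suc t)))

  exSets : ∀ {f s} j → Form f (j + s) → Form f s
  exSets zero ψ = ψ
  exSets (suc j) ψ = exSets j (ex2 ψ)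

  extendSets : ∀ {s} j → (Fin j → List Bool) → (Fin s → ℕ → Bool) → Fin (j + s) → ℕ → Bool
  extendSets zero τ σ = σ
  extendSets (suc j) τ σ = bitAt (τ F.zero) VF.∷ extendSets j (λ q → τ (F.suc q)) σ

  extendSets-↑ˡ : ∀ {s} j τ (σ : Fin s → ℕ → Bool) q → extendSets j τ σ (q ↑ˡ s) ≡ bitAt (τ q)
  extendSets-↑ˡ (suc j) τ σ F.zero = refl
  extendSets-↑ˡ (suc j) τ σ (F.suc q) = extendSets-↑ˡ j (λ q → τ (F.suc q)) σ q

  module _ {f s : ℕ} (u : List (Fin k)) where
    sat-disjˡ : ∀ φ ψ (ρ : Fin f → ℕ) (σ : Fin s → ℕ → Bool) → sat φ u ρ σ ≡ true → sat (disj φ ψ) u ρ σ ≡ true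
    sat-disjˡ φ ψ ρ σ e rewrite e = refl

    sat-disjʳ : ∀ φ ψ (ρ : Fin f → ℕ) (σ : Fin s → ℕ → Bool) → sat ψ u ρ σ ≡ true → sat (disj φ ψ) u ρ σ ≡ true
    sat-disjʳ φ ψ ρ σ e rewrite e with sat φ u ρ σ
    ... | true = refl
    ... | false = refl

    sat-disj⁻ : ∀ φ ψ (ρ : Fin f → ℕ) (σ : Fin s → ℕ → Bool) → sat (disj φ ψ) u ρ σ ≡ true →
      sat φ u ρ σ ≡ true ⊎ sat ψ u ρ σ ≡ true
    sat-disj⁻ φ ψ ρ σ e with sat φ u ρ σ | sat ψ u ρ σ
    ... | true | _ = inj₁ refl
    ... | false | true = inj₂ refl
    sat-disj⁻ φ ψ ρ σ () | false | false

    sat-impl⁻ : ∀ φ ψ (ρ : Fin f → ℕ) (σ : Fin s → ℕ → Bool) → sat (impl φ ψ) u ρ σ ≡ true →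
      sat φ u ρ σ ≡ true → sat ψ u ρ σ ≡ true
    sat-impl⁻ φ ψ ρ σ e h rewrite h with sat ψ u ρ σ
    ... | true = refl

    sat-impl : ∀ φ ψ (ρ : Fin f → ℕ) (σ : Fin s → ℕ → Bool) →
      (sat φ u ρ σ ≡ true → sat ψ u ρ σ ≡ true) → sat (impl φ ψ) u ρ σ ≡ true
    sat-impl φ ψ ρ σ h with sat φ u ρ σ
    ... | false = refl
    ... | true rewrite h refl = refl

    sat-conjAll⁻ : ∀ N truth g (ρ : Fin f → ℕ) (σ : Fin s → ℕ → Bool) → sat (conjAll N truth g) u ρ σ ≡ true →
      ∀ t → sat (g t) u ρ σ ≡ true
    sat-conjAll⁻ (suc N) truth g ρ σ e F.zero = ∧-trueˡ e
    sat-conjAll⁻ (suc N) truth g ρ σ e (F.suc t) =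
      sat-conjAll⁻ N truth (λ t → g (F.suc t)) ρ σ (∧-trueʳ {sat (g F.zero) u ρ σ} e) t

    sat-conjAll : ∀ N truth g (ρ : Fin f → ℕ) (σ : Fin s → ℕ → Bool) → sat truth u ρ σ ≡ true →
      (∀ t → sat (g t) u ρ σ ≡ true) → sat (conjAll N truth g) u ρ σ ≡ true
    sat-conjAll zero truth g ρ σ e h = e
    sat-conjAll (suc N) truth g ρ σ e h =
      ∧-true (h F.zero) (sat-conjAll N truth (λ t → g (F.suc t)) ρ σ e (λ t → h (F.suc t)))

    sat-all1⁻ : ∀ (φ : Form (suc f) s) ρ σ → sat (all1 φ) u ρ σ ≡ true → ∀ p → p < length u →
      sat φ u (p VF.∷ ρ) σ ≡ true
    sat-all1⁻ φ ρ σ e p lt with true-or-false (sat φ u (p VF.∷ ρ) σ)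
    ... | inj₁ x = x
    ... | inj₂ x = ⊥-elim (false≢true (not-true⁻ e) (anyBelow-complete (length u) _ p lt (not-true x)))

    sat-all1 : ∀ (φ : Form (suc f) s) ρ σ → (∀ p → p < length u → sat φ u (p VF.∷ ρ) σ ≡ true) →
      sat (all1 φ) u ρ σ ≡ true
    sat-all1 φ ρ σ h with true-or-false (anyBelow (length u) (λ p → not (sat φ u (p VF.∷ ρ) σ)))
    ... | inj₂ x = not-true x
    ... | inj₁ x = let (p , lt , np) = anyBelow-sound (length u) _ x in
      ⊥-elim (false≢true (not-true⁻ np) (h p lt))

  sat-exSets⁻ : ∀ {f s} j (ψ : Form f (j + s)) u ρ σ → sat (exSets j ψ) u ρ σ ≡ true →
    Σ (Fin j → List Bool) λ τ → sat ψ u ρ (extendSets j τ σ) ≡ true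
  sat-exSets⁻ zero ψ u ρ σ e = (λ ()) , e
  sat-exSets⁻ (suc j) ψ u ρ σ e =
    let (τ' , e') = sat-exSets⁻ j (ex2 ψ) u ρ σ e
        (t , lt , e'') = anyBits-sound (length u) _ e'
    in (t VF.∷ τ') , e''

  sat-exSets : ∀ {f s} j (ψ : Form f (j + s)) u ρ σ τ → (∀ q → length (τ q) ≡ length u) →
    sat ψ u ρ (extendSets j τ σ) ≡ true → sat (exSets j ψ) u ρ σ ≡ true
  sat-exSets zero ψ u ρ σ τ lτ e = e
  sat-exSets (suc j) ψ u ρ σ τ lτ e =
    sat-exSets j (ex2 ψ) u ρ σ (λ q → τ (F.suc q)) (λ q → lτ (F.suc q))
      (anyBits-complete (length u) _ (τ F.zero) (lτ F.zero) e)

-- The sentence guesses one set X_q per state q and states that the sets describe the run: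
-- the first position lies in X_{q₀}, and a position in X_q reading a goes to X_{q'} (at its
-- successor) or makes F_{q'} hold (at the last position) whenever T_{q,a,q'} holds there.
module MSOOfAutomaton {k : ℕ} (D : DAutomaton k) where
  open DAutomaton D
  open DAutomatonRuns D

  ℓ : ℕ
  ℓ = m * (k * m) + m

  decodeTransition : Fin (m * (k * m)) → Fin m × Fin k × Fin m
  decodeTransition t = proj₁ (remQuot {m} (k * m) t) , remQuot {k} m (proj₂ (remQuot {m} (k * m) t))

  decodeTransition-combine : ∀ q a q' → decodeTransition (combine q (combine a q')) ≡ (q , a , q')
  decodeTransition-combine q a q' =
    trans (cong (λ z → proj₁ z , remQuot {k} m (proj₂ z)) (FP.remQuot-combine {m} {k * m} q (combine a q')))
          (cong (q ,_) (FP.remQuot-combine {k} {m} a q'))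

  transitionPredicate : Fin m × Fin k × Fin m → MonPred
  transitionPredicate (q , a , q') n i = δ i n q a ≟ᵇ q'

  predicate : Fin (m * (k * m)) ⊎ Fin m → MonPred
  predicate (inj₁ t) = transitionPredicate (decodeTransition t)
  predicate (inj₂ q') n i = Fin' n q'

  Ps : Fin ℓ → MonPred
  Ps j = predicate (splitAt (m * (k * m)) j)

  transitionIndex : Fin m → Fin k → Fin m → Fin ℓ
  transitionIndex q a q' = combine q (combine a q') ↑ˡ m

  finalIndex : Fin m → Fin ℓ
  finalIndex q' = (m * (k * m)) ↑ʳ q'

  Ps-transitionIndex : ∀ q a q' n i → Ps (transitionIndex q a q') n i ≡ (δ i n q a ≟ᵇ q')
  Ps-transitionIndex q a q' n i =
    trans (cong (λ z → predicate z n i) (FP.splitAt-↑ˡ (m * (k * m)) (combine q (combine a q')) m))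
          (cong (λ z → transitionPredicate z n i) (decodeTransition-combine q a q'))

  Ps-finalIndex : ∀ q' n i → Ps (finalIndex q' ) n i ≡ Fin' n q'
  Ps-finalIndex q' n i = cong (λ z → predicate z n i) (FP.splitAt-↑ʳ (m * (k * m)) m q')

  open Semantics {k} {ℓ} Ps
  open Connectives {k} {ℓ} Ps

  Sets : ℕ
  Sets = m + 0

  stateSet : Fin m → Fin Sets
  stateSet q = q ↑ˡ 0

  v₀ : ∀ {f} → Fin (suc f)
  v₀ = F.zero

  v₁ : ∀ {f} → Fin (suc (suc f))
  v₁ = F.suc F.zero

  v₂ : ∀ {f} → Fin (suc (suc (suc f)))
  v₂ = F.suc (F.suc F.zero)

  isFirst : Form 1 Sets
  isFirst = all1 (leq v₁ v₀)

  isLast : Form 1 Sets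
  isLast = all1 (leq v₀ v₁)

  -- v₀ = v₁ + 1
  isSucc : Form 2 Sets
  isSucc = and (leq v₁ v₀) (and (neg (leq v₀ v₁)) (all1 (disj (leq v₀ v₂) (leq v₁ v₀))))

  conjTriples : ∀ {f} → (Fin m → Fin k → Fin m → Form (suc f) Sets) → Form (suc f) Sets
  conjTriples h = conjAll m (leq v₀ v₀) (λ q → conjAll k (leq v₀ v₀) (λ a → conjAll m (leq v₀ v₀) (λ q' → h q a q')))

  inStateReading : ∀ {f} → Fin f → Fin m → Fin k → Fin m → Form f Sets
  inStateReading x q a q' = and (mem x (stateSet q)) (and (letter a x) (pred (transitionIndex q a q') x))

  stepToSucc : Fin m → Fin k → Fin m → Form 2 Sets
  stepToSucc q a q' = impl (inStateReading v₁ q a q') (mem v₀ (stateSet q'))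

  stepToFinal : Fin m → Fin k → Fin m → Form 1 Sets
  stepToFinal q a q' = impl (inStateReading v₀ q a q') (pred (finalIndex q') v₀)

  initial : Form 0 Sets
  initial = all1 (impl isFirst (mem v₀ (stateSet q₀)))

  transitions : Form 0 Sets
  transitions = all1 (all1 (impl isSucc (conjTriples stepToSucc)))

  final : Form 0 Sets
  final = all1 (impl isLast (conjTriples stepToFinal))

  -- Acceptance of the empty word is decided by Fin' 0 q₀, a constant of the construction.
  emptyCase : Bool → Form 0 Sets
  emptyCase true = neg (ex1 (neg (leq v₀ v₀)))
  emptyCase false = ex1 (leq v₀ v₀)

  runEncoding : Form 0 Sets
  runEncoding = and initial (and transitions (and final (emptyCase (Fin' 0 q₀))))

  sentence : Sentence k ℓ
  sentence = exSets m runEncoding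

  ρ₀ : Fin 0 → ℕ
  ρ₀ = λ ()

  σ₀ : Fin 0 → ℕ → Bool
  σ₀ = λ ()

  module OnWord (u : List (Fin k)) where
    n = length u

    state : ℕ → Fin m
    state zero = q₀
    state (suc p) = M.maybe′ (δ p n (state p)) (state p) (at u p)

    state-suc : ∀ p a → at u p ≡ just a → state (suc p) ≡ δ p n (state p) a
    state-suc p a e rewrite e = refl

    runFrom-state : ∀ y j → (∀ p → at y p ≡ at u (j + p)) → runFrom j n (state j) y ≡ state (j + length y)
    runFrom-state [] j h = cong state (sym (NP.+-identityʳ j))
    runFrom-state (a ∷ y) j h =
      let at-j : at u j ≡ just a
          at-j = trans (cong (at u) (sym (NP.+-identityʳ j))) (sym (h 0))
      in trans (cong (λ z → runFrom (suc j) n z y) (sym (state-suc j a at-j)))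
          (trans (runFrom-state y (suc j) (λ p → trans (h (suc p)) (cong (at u) (NP.+-suc j p))))
            (cong state (sym (NP.+-suc j (length y)))))

    runFrom≡state : runFrom 0 n q₀ u ≡ state n
    runFrom≡state = runFrom-state u 0 (λ p → refl)

    module _ (τ : Fin m → List Bool) where
      σ = extendSets m τ σ₀

      sat-mem : ∀ {f} (x : Fin f) q (ρ : Fin f → ℕ) → sat (mem x (stateSet q)) u ρ σ ≡ bitAt (τ q) (ρ x)
      sat-mem x q ρ = cong (λ g → g (ρ x)) (extendSets-↑ˡ m τ σ₀ q)

      sat-inStateReading⁻ : ∀ {f} (x : Fin f) q a q' (ρ : Fin f → ℕ) → sat (inStateReading x q a q') u ρ σ ≡ true →
        bitAt (τ q) (ρ x) ≡ true × at u (ρ x) ≡ just a × δ (ρ x) n q a ≡ q'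
      sat-inStateReading⁻ x q a q' ρ e =
        let (in-q , rest) = ∧-true⁻ {sat (mem x (stateSet q)) u ρ σ} e
            (reads-a , steps) = ∧-true⁻ {M.maybe′ (_≟ᵇ a) false (at u (ρ x))} rest in
        trans (sym (sat-mem x q ρ)) in-q ,
        maybe′-≟ᵇ-true (at u (ρ x)) reads-a ,
        ≟ᵇ⇒≡ (trans (sym (Ps-transitionIndex q a q' n (ρ x))) steps)

      sat-inStateReading : ∀ {f} (x : Fin f) q a (ρ : Fin f → ℕ) → bitAt (τ q) (ρ x) ≡ true → at u (ρ x) ≡ just a →
        sat (inStateReading x q a (δ (ρ x) n q a)) u ρ σ ≡ true
      sat-inStateReading x q a ρ in-q reads-a = ∧-true (trans (sat-mem x q ρ) in-q)
        (∧-true (trans (cong (M.maybe′ (_≟ᵇ a) false) reads-a) (≟ᵇ-refl a))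
                (trans (Ps-transitionIndex q a _ n (ρ x)) (≟ᵇ-refl _)))

      sat-conjTriples⁻ : ∀ {f} h (ρ : Fin (suc f) → ℕ) → sat (conjTriples h) u ρ σ ≡ true →
        ∀ q a q' → sat (h q a q') u ρ σ ≡ true
      sat-conjTriples⁻ h ρ e q a q' =
        sat-conjAll⁻ u m _ _ ρ σ (sat-conjAll⁻ u k _ _ ρ σ (sat-conjAll⁻ u m _ _ ρ σ e q) a) q'

      sat-conjTriples : ∀ {f} h (ρ : Fin (suc f) → ℕ) → (∀ q a q' → sat (h q a q') u ρ σ ≡ true) →
        sat (conjTriples h) u ρ σ ≡ true
      sat-conjTriples h ρ e =
        sat-conjAll u m _ _ ρ σ (≤ᵇ-refl (ρ v₀)) λ q → sat-conjAll u k _ _ ρ σ (≤ᵇ-refl (ρ v₀)) λ a →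
          sat-conjAll u m _ _ ρ σ (≤ᵇ-refl (ρ v₀)) λ q' → e q a q'

    module _ (ρ : Fin 1 → ℕ) (σ' : Fin Sets → ℕ → Bool) where

      sat-isFirst⁻ : sat isFirst u ρ σ' ≡ true → 0 < n → ρ v₀ ≡ 0
      sat-isFirst⁻ e lt = NP.n≤0⇒n≡0 (≤ᵇ-true⇒≤ (sat-all1⁻ u (leq v₁ v₀) ρ σ' e 0 lt))

      sat-isFirst : ρ v₀ ≡ 0 → sat isFirst u ρ σ' ≡ true
      sat-isFirst h = sat-all1 u (leq v₁ v₀) ρ σ' λ y _ → ≤⇒≤ᵇ-true (subst (_≤ y) (sym h) z≤n)

      sat-isLast⁻ : sat isLast u ρ σ' ≡ true → ρ v₀ < n → suc (ρ v₀) ≡ n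
      sat-isLast⁻ e lt with NP.m≤n⇒m<n∨m≡n lt
      ... | inj₂ last = last
      ... | inj₁ not-last = ⊥-elim (NP.<-irrefl refl
              (≤ᵇ-true⇒≤ {suc (ρ v₀)} {ρ v₀} (sat-all1⁻ u (leq v₀ v₁) ρ σ' e (suc (ρ v₀)) not-last)))

      sat-isLast : suc (ρ v₀) ≡ n → sat isLast u ρ σ' ≡ true
      sat-isLast h = sat-all1 u (leq v₀ v₁) ρ σ' λ y lt → ≤⇒≤ᵇ-true (NP.≤-pred (subst (y <_) (sym h) lt))

    module _ (ρ : Fin 2 → ℕ) (σ' : Fin Sets → ℕ → Bool) where
      private
        between : Form 3 Sets
        between = disj (leq v₀ v₂) (leq v₁ v₀)

      sat-isSucc⁻ : sat isSucc u ρ σ' ≡ true → ρ v₀ < n → ρ v₀ ≡ suc (ρ v₁)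
      sat-isSucc⁻ e lt =
        let (_ , rest) = ∧-true⁻ {ρ v₁ ≤ᵇ ρ v₀} e
            (y≰p , no-gap) = ∧-true⁻ {not (ρ v₀ ≤ᵇ ρ v₁)} rest
            p<y : ρ v₁ < ρ v₀
            p<y = NP.≰⇒> (λ le → false≢true (not-true⁻ y≰p) (≤⇒≤ᵇ-true le))
            1+p<n = NP.<-≤-trans (s≤s p<y) lt
        in [ (λ 1+p≤p → ⊥-elim (NP.<-irrefl refl (≤ᵇ-true⇒≤ {suc (ρ v₁)} {ρ v₁} 1+p≤p)))
           , (λ y≤1+p → NP.≤-antisym (≤ᵇ-true⇒≤ y≤1+p) p<y) ]′
           (sat-disj⁻ u (leq v₀ v₂) (leq v₁ v₀) (suc (ρ v₁) VF.∷ ρ) σ' (sat-all1⁻ u between ρ σ' no-gap (suc (ρ v₁)) 1+p<n))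

      sat-isSucc : ρ v₀ ≡ suc (ρ v₁) → sat isSucc u ρ σ' ≡ true
      sat-isSucc h =
        ∧-true (≤⇒≤ᵇ-true (subst (ρ v₁ ≤_) (sym h) (NP.n≤1+n (ρ v₁))))
          (∧-true (not-true (>⇒≤ᵇ-false (subst (ρ v₁ <_) (sym h) NP.≤-refl)))
            (sat-all1 u between ρ σ' λ z _ → no-gap z))
        where
          no-gap : ∀ z → sat between u (z VF.∷ ρ) σ' ≡ true
          no-gap z with z N.≤? ρ v₁
          ... | yes z≤p = sat-disjˡ u (leq v₀ v₂) (leq v₁ v₀) (z VF.∷ ρ) σ' (≤⇒≤ᵇ-true z≤p)
          ... | no z≰p = sat-disjʳ u (leq v₀ v₂) (leq v₁ v₀) (z VF.∷ ρ) σ'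
                           (≤⇒≤ᵇ-true (subst (_≤ z) (sym h) (NP.≰⇒> z≰p)))

    sat-emptyCase : ∀ b (σ' : Fin Sets → ℕ → Bool) → (b ≡ true ⊎ 0 < n) → sat (emptyCase b) u ρ₀ σ' ≡ true
    sat-emptyCase true σ' _ =
      not-true (trans (anyBelow-cong n _ _ (λ p _ → cong not (≤ᵇ-refl p))) (anyBelow-false n))
    sat-emptyCase false σ' (inj₂ lt) = anyBelow-complete n _ 0 lt refl

    sat-emptyCase⁻ : ∀ b (σ' : Fin Sets → ℕ → Bool) → sat (emptyCase b) u ρ₀ σ' ≡ true → n ≡ 0 → b ≡ true
    sat-emptyCase⁻ true σ' e _ = refl
    sat-emptyCase⁻ false σ' e n≡0 = let (p , lt , _) = anyBelow-sound n _ e in ⊥-elim (NP.n≮0 (subst (p <_) n≡0 lt))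

    module FromSets (τ : Fin m → List Bool) (e : sat runEncoding u ρ₀ (σ τ) ≡ true) where
      private
        parts = ∧-true⁻ {sat initial u ρ₀ (σ τ)} e
        sat-initial⁻ = proj₁ parts
        rest = ∧-true⁻ {sat transitions u ρ₀ (σ τ)} (proj₂ parts)
        sat-transitions⁻ = proj₁ rest
        rest' = ∧-true⁻ {sat final u ρ₀ (σ τ)} (proj₂ rest)
        sat-final⁻ = proj₁ rest'
        sat-emptyCase′ = proj₂ rest'

      state∈ : ∀ p → p < n → bitAt (τ (state p)) p ≡ true
      state∈ zero lt = trans (sym (sat-mem τ v₀ q₀ (0 VF.∷ ρ₀)))
        (sat-impl⁻ u isFirst (mem v₀ (stateSet q₀)) (0 VF.∷ ρ₀) (σ τ)
          (sat-all1⁻ u (impl isFirst (mem v₀ (stateSet q₀))) ρ₀ (σ τ) sat-initial⁻ 0 lt)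
          (sat-isFirst (0 VF.∷ ρ₀) (σ τ) refl))
      state∈ (suc p) lt =
        let p<n = NP.<-trans (NP.n<1+n p) lt
            (a , reads-a) = at-< u p p<n
            ρ = suc p VF.∷ p VF.∷ ρ₀
            q' = δ p n (state p) a
            at-p = sat-all1⁻ u (all1 (impl isSucc (conjTriples stepToSucc))) ρ₀ (σ τ) sat-transitions⁻ p p<n
            at-p,1+p = sat-all1⁻ u (impl isSucc (conjTriples stepToSucc)) (p VF.∷ ρ₀) (σ τ) at-p (suc p) lt
            steps = sat-impl⁻ u isSucc (conjTriples stepToSucc) ρ (σ τ) at-p,1+p (sat-isSucc ρ (σ τ) refl)
            step = sat-conjTriples⁻ τ stepToSucc ρ steps (state p) a q'
            in-q' = sat-impl⁻ u (inStateReading v₁ (state p) a q') (mem v₀ (stateSet q')) ρ (σ τ) step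
                      (sat-inStateReading τ v₁ (state p) a ρ (state∈ p p<n) reads-a)
        in subst (λ z → bitAt (τ z) (suc p) ≡ true) (sym (state-suc p a reads-a))
             (trans (sym (sat-mem τ v₀ q' ρ)) in-q')

      accepts-nonempty : ∀ p → suc p ≡ n → Fin' n (state n) ≡ true
      accepts-nonempty p 1+p≡n =
        let p<n = subst (p <_) 1+p≡n NP.≤-refl
            (a , reads-a) = at-< u p p<n
            ρ = p VF.∷ ρ₀
            q' = δ p n (state p) a
            at-p = sat-all1⁻ u (impl isLast (conjTriples stepToFinal)) ρ₀ (σ τ) sat-final⁻ p p<n
            steps = sat-impl⁻ u isLast (conjTriples stepToFinal) ρ (σ τ) at-p (sat-isLast ρ (σ τ) 1+p≡n)
            step = sat-conjTriples⁻ τ stepToFinal ρ steps (state p) a q'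
            final-q' = sat-impl⁻ u (inStateReading v₀ (state p) a q') (pred (finalIndex q') v₀) ρ (σ τ) step
                         (sat-inStateReading τ v₀ (state p) a ρ (state∈ p p<n) reads-a)
        in subst (λ z → Fin' n z ≡ true) (trans (sym (state-suc p a reads-a)) (cong state 1+p≡n))
             (trans (sym (Ps-finalIndex q' n p)) final-q')

      accepts-empty : n ≡ 0 → Fin' 0 q₀ ≡ true
      accepts-empty = sat-emptyCase⁻ (Fin' 0 q₀) (σ τ) sat-emptyCase′

    module RunSets (accepts : Fin' n (state n) ≡ true) (accepts-empty : Fin' 0 q₀ ≡ true ⊎ 0 < n) where
      τ : Fin m → List Bool
      τ q = L.tabulate {n = n} (λ i → state (toℕ i) ≟ᵇ q)

      τ-state : ∀ q p → p < n → bitAt (τ q) p ≡ (state p ≟ᵇ q)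
      τ-state q p lt = bitAt-tabulate-toℕ (λ p → state p ≟ᵇ q) p lt

      sat-mem-state : ∀ {f} (x : Fin f) q (ρ : Fin f → ℕ) → ρ x < n → state (ρ x) ≡ q →
        sat (mem x (stateSet q)) u ρ (σ τ) ≡ true
      sat-mem-state x q ρ lt e =
        trans (sat-mem τ x q ρ) (trans (τ-state q (ρ x) lt) (trans (cong (_≟ᵇ q) e) (≟ᵇ-refl q)))

      state-∈ : ∀ {f} (x : Fin f) q (ρ : Fin f → ℕ) → ρ x < n → bitAt (τ q) (ρ x) ≡ true → state (ρ x) ≡ q
      state-∈ x q ρ lt e = ≟ᵇ⇒≡ (trans (sym (τ-state q (ρ x) lt)) e)

      state-step : ∀ {f} (x : Fin f) q a q' (ρ : Fin f → ℕ) → ρ x < n →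
        sat (inStateReading x q a q') u ρ (σ τ) ≡ true → state (suc (ρ x)) ≡ q'
      state-step x q a q' ρ lt e =
        let (in-q , reads-a , steps) = sat-inStateReading⁻ τ x q a q' ρ e in
        trans (state-suc (ρ x) a reads-a) (trans (cong (λ z → δ (ρ x) n z a) (state-∈ x q ρ lt in-q)) steps)

      sat-initial : sat initial u ρ₀ (σ τ) ≡ true
      sat-initial = sat-all1 u (impl isFirst (mem v₀ (stateSet q₀))) ρ₀ (σ τ) λ p lt →
        sat-impl u isFirst (mem v₀ (stateSet q₀)) (p VF.∷ ρ₀) (σ τ) λ first →
          sat-mem-state v₀ q₀ (p VF.∷ ρ₀) lt (cong state (sat-isFirst⁻ (p VF.∷ ρ₀) (σ τ) first (NP.≤-trans (s≤s z≤n) lt)))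

      sat-transitions : sat transitions u ρ₀ (σ τ) ≡ true
      sat-transitions = sat-all1 u (all1 (impl isSucc (conjTriples stepToSucc))) ρ₀ (σ τ) λ p p<n →
        sat-all1 u (impl isSucc (conjTriples stepToSucc)) (p VF.∷ ρ₀) (σ τ) λ y y<n →
        sat-impl u isSucc (conjTriples stepToSucc) (y VF.∷ p VF.∷ ρ₀) (σ τ) λ succ →
        sat-conjTriples τ stepToSucc (y VF.∷ p VF.∷ ρ₀) λ q a q' →
          sat-impl u (inStateReading v₁ q a q') (mem v₀ (stateSet q')) (y VF.∷ p VF.∷ ρ₀) (σ τ) λ reading →
            sat-mem-state v₀ q' (y VF.∷ p VF.∷ ρ₀) y<n
              (trans (cong state (sat-isSucc⁻ (y VF.∷ p VF.∷ ρ₀) (σ τ) succ y<n))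
                     (state-step v₁ q a q' (y VF.∷ p VF.∷ ρ₀) p<n reading))

      sat-final : sat final u ρ₀ (σ τ) ≡ true
      sat-final = sat-all1 u (impl isLast (conjTriples stepToFinal)) ρ₀ (σ τ) λ p p<n →
        sat-impl u isLast (conjTriples stepToFinal) (p VF.∷ ρ₀) (σ τ) λ last →
        sat-conjTriples τ stepToFinal (p VF.∷ ρ₀) λ q a q' →
          sat-impl u (inStateReading v₀ q a q') (pred (finalIndex q') v₀) (p VF.∷ ρ₀) (σ τ) λ reading →
            let ends-in-q' = trans (cong state (sym (sat-isLast⁻ (p VF.∷ ρ₀) (σ τ) last p<n)))
                                   (state-step v₀ q a q' (p VF.∷ ρ₀) p<n reading)
            in trans (Ps-finalIndex q' n p) (subst (λ z → Fin' n z ≡ true) ends-in-q' accepts)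

      sat-sentence : sat sentence u ρ₀ σ₀ ≡ true
      sat-sentence = sat-exSets m runEncoding u ρ₀ σ₀ τ (λ q → LP.length-tabulate _)
        (∧-true sat-initial (∧-true sat-transitions (∧-true sat-final
          (sat-emptyCase (Fin' 0 q₀) (σ τ) accepts-empty))))

  open OnWord

  sat-sentence⇔ : ∀ u → (sat sentence u ρ₀ σ₀ ≡ true) ⇔ (Fin' (length u) (state u (length u)) ≡ true)
  sat-sentence⇔ u = mk⇔ (from-sets u) (to-sets u)
    where
      from-sets : ∀ u → sat sentence u ρ₀ σ₀ ≡ true → Fin' (length u) (state u (length u)) ≡ true
      from-sets u e with sat-exSets⁻ m runEncoding u ρ₀ σ₀ e
      from-sets [] e | τ , e' = FromSets.accepts-empty [] τ e' refl
      from-sets (a ∷ w) e | τ , e' = FromSets.accepts-nonempty (a ∷ w) τ e' (length w) refl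
      to-sets : ∀ u → Fin' (length u) (state u (length u)) ≡ true → sat sentence u ρ₀ σ₀ ≡ true
      to-sets [] accepts = RunSets.sat-sentence [] accepts (inj₁ accepts)
      to-sets (a ∷ w) accepts = RunSets.sat-sentence (a ∷ w) accepts (inj₂ (s≤s z≤n))

  correct : ∀ {L : Language k} → (∀ u → (L u ≡ true) ⇔ NAccepts (DtoN D) u) → ∀ u → (L u ≡ true) ⇔ Models u Ps sentence
  correct L⇔D u =
    ⇔-trans (L⇔D u) (⇔-trans (DAccepts⇔final u)
      (⇔-trans (subst (λ z → (Fin' (length u) (runFrom 0 (length u) q₀ u) ≡ true) ⇔ (Fin' (length u) z ≡ true))
                      (runFrom≡state u) (mk⇔ (λ x → x) (λ x → x)))
        (⇔-trans (⇔-sym (sat-sentence⇔ u))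
                 (⇔-sym (Sat⇔sat sentence u {ρ' = ρ₀} {σ₀} (λ ()) (λ ()))))))

dRecognizable⇒msoDefinable : ∀ {k} (L : Language k) → DRecognizable L → MSODefinable L
dRecognizable⇒msoDefinable L (D , L⇔D) = MSOOfAutomaton.ℓ D , MSOOfAutomaton.sentence D , MSOOfAutomaton.Ps D ,
  MSOOfAutomaton.correct D L⇔D

mainTheorem1 : ∀ (k : ℕ) (L : Language k) →
    (MSODefinable L ⇔ NRecognizable L)
    × (MSODefinable L ⇔ DRecognizable L)
    × (MSODefinable L ⇔ BoundedIndex L)
    × (MSODefinable L ⇔ OneScanRecognizable L)
mainTheorem1 k L =
  mk⇔ (λ h → dRecognizable⇒nRecognizable L (mso⇒dRec h))
      (λ h → bi⇒mso (refinedBoundedIndex⇒boundedIndex L (nRecognizable⇒refinedBoundedIndex L h))) ,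
  mk⇔ mso⇒dRec (dRecognizable⇒msoDefinable L) ,
  mk⇔ mso⇒bi bi⇒mso ,
  mk⇔ (λ h → dRecognizable⇒oneScanRecognizable L (mso⇒dRec h))
      (λ h → bi⇒mso (refinedBoundedIndex⇒boundedIndex L (oneScanRecognizable⇒refinedBoundedIndex L h)))
  where
    mso⇒bi : MSODefinable L → BoundedIndex L
    mso⇒bi h = refinedBoundedIndex⇒boundedIndex L (msoDefinable⇒refinedBoundedIndex L h)
    mso⇒dRec : MSODefinable L → DRecognizable L
    mso⇒dRec h = boundedIndex⇒dRecognizable L (mso⇒bi h)
    bi⇒mso : BoundedIndex L → MSODefinable L
    bi⇒mso h = dRecognizable⇒msoDefinable L (boundedIndex⇒dRecognizable L h)
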